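{- Define $K_0(x) = 0$ and $K_j(x) = \dfrac{x}{1-x-K_{j-1}(x)}$ for $j\ge1$ (so $K_j$ is the finite continued fraction with $j$ denominators each of the form $1-x$ and all numerators $x$). Then for all $k\ge2$, $$\sum_{n=0}^\infty |\mathfrak{S}_n(1243,2143,2134\cdots k)|\,x^n = 1 + K_{k-1}(x).$$
   Context: $\mathfrak{S}_n(R)$ is the set of permutations of $\{1,\dots,n\}$ containing no subsequence with the same relative order as any pattern in $R$. $2134\cdots k$ denotes the permutation $2,1,3,4,\dots,k$ (for $k=2$ it is $21$). -}

module Defs where

open import Data.Bool using (Bool; true; false; if_then_else_; _∧_; not)
open import Data.Nat as ℕ using (ℕ; zero; suc; _∸_; _<ᵇ_; _≡ᵇ_; _≤ᵇ_)
open import Data.List using (List; []; _∷_; length; filter; map; concatMap; upTo; _++_)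
open import Data.Bool.ListAction using (all; any)
open import Data.Integer as ℤ using (ℤ; +_; -_)
open import Relation.Nullary.Decidable using (T?)

_==_ : Bool → Bool → Bool
true  == b = b
false == b = not b

subseqs : List ℕ → List (List ℕ)
subseqs []       = [] ∷ []
subseqs (x ∷ xs) = map (x ∷_) (subseqs xs) ++ subseqs xs

sameFirst : ℕ → ℕ → List ℕ → List ℕ → Bool
sameFirst p q (p' ∷ ps) (q' ∷ qs) = ((p <ᵇ p') == (q <ᵇ q')) ∧ sameFirst p q ps qs
sameFirst p q []        []        = true
sameFirst p q _         _         = false

-- two sequences (of distinct entries) are order-isomorphic:
-- same length and for all positions i < j, (p_i < p_j) ⟺ (q_i < q_j)
sameOrder : List ℕ → List ℕ → Bool
sameOrder []       []       = true
sameOrder (p ∷ ps) (q ∷ qs) = sameFirst p q ps qs ∧ sameOrder ps qs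
sameOrder _        _        = false

contains : List ℕ → List ℕ → Bool
contains σ π = any (sameOrder π) (subseqs σ)

avoidsAll : List (List ℕ) → List ℕ → Bool
avoidsAll R σ = all (λ π → not (contains σ π)) R

words : ℕ → ℕ → List (List ℕ)
words n zero    = [] ∷ []
words n (suc m) = concatMap (λ w → map (_∷ w) (map suc (upTo n))) (words n m)

distinct : List ℕ → Bool
distinct []       = true
distinct (x ∷ xs) = all (λ y → not (x ≡ᵇ y)) xs ∧ distinct xs

perms : ℕ → List (List ℕ)
perms n = filter (λ w → T? (distinct w)) (words n n)

avCount : List (List ℕ) → ℕ → ℕ
avCount R n = length (filter (λ σ → T? (avoidsAll R σ)) (perms n))

pat2134 : ℕ → List ℕ
pat2134 k = 2 ∷ 1 ∷ map (λ i → i ℕ.+ 3) (upTo (k ∸ 2))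

Rk : ℕ → List (List ℕ)
Rk k = (1 ∷ 2 ∷ 4 ∷ 3 ∷ []) ∷ (2 ∷ 1 ∷ 4 ∷ 3 ∷ []) ∷ pat2134 k ∷ []

Series : Set
Series = ℕ → ℤ

sumBelow : ℕ → (ℕ → ℤ) → ℤ
sumBelow zero    f = + 0
sumBelow (suc n) f = sumBelow n f ℤ.+ f n

0s 1s X : Series
0s _ = + 0
1s n = if n ≡ᵇ 0 then + 1 else + 0
X  n = if n ≡ᵇ 1 then + 1 else + 0

_⊕_ _⊖_ _⊗_ : Series → Series → Series
(a ⊕ b) n = a n ℤ.+ b n
(a ⊖ b) n = a n ℤ.- b n
(a ⊗ b) n = sumBelow (suc n) (λ i → a i ℤ.* b (n ∸ i))

-- truncated inverse: invT a N agrees with a⁻¹ on coefficients 0..N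
-- (valid when a 0 = 1):  b₀ = 1,  b_m = - Σ_{i=1}^{m} a_i b_{m-i}
invT : Series → ℕ → Series
invT a zero    m = 1s m
invT a (suc N) m =
  if m ≤ᵇ N then invT a N m
  else if m ≡ᵇ suc N
       then - sumBelow (suc N) (λ j → a (suc j) ℤ.* invT a N (N ∸ j))
       else + 0

-- multiplicative inverse of a power series with constant term 1
inv : Series → Series
inv a m = invT a m m

K : ℕ → Series
K zero    = 0s
K (suc j) = X ⊗ inv ((1s ⊖ X) ⊖ K j)

-- Write σ ∈ 𝔖ₙ(1243, 2143, 2134⋯k) as σ = γ n δ.  If n comes first (k ≥ 3), deleting it is a
-- bijection onto 𝔖ₙ₋₁(1243, 2143, 2134⋯k).  Otherwise let a = |γ| ≥ 1 and b = n - a.  A letter d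
-- of δ exceeds at most one letter of γ (else n d completes a 1243 or 2143), so counting the letters
-- ≤ d shows that δ ⊆ [1, b] and that γ has exactly one letter e ≤ b.  Then σ ↦ (standardised γ, e δ)
-- is a bijection onto 𝔖_a(1243, 2143, 2134⋯(k-1)) × 𝔖_b(1243, 2143, 2134⋯k): γ n contains 2134⋯k
-- iff γ contains 2134⋯(k-1), and an occurrence reaching into δ lies in e δ, for otherwise its first
-- two letters, which lie below its last letter and hence below b, would both be in γ.
-- Consequently the counts aₙ satisfy a_{n+2} = a_{n+1} + Σ_{i ≤ n} a′_{i+1} a_{n+1-i}, where a′
-- counts for k - 1; this is the coefficient form of K_{k-1} = x + x K_{k-1} + K_{k-2} K_{k-1}, and
-- both sequences start with a₁ = 1.  For k = 2 a 21-avoider ends with its maximum, so a_{n+2} =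
-- a_{n+1}, the recurrence of K₁ = x / (1 - x).

module Submission where

open import Defs
open import Data.Nat using (ℕ; _≤_; _∸_)
open import Data.Integer using (+_)
open import Relation.Binary.PropositionalEquality using (_≡_)

open import Data.Bool using (Bool; true; false; T; not; _∧_; if_then_else_)
open import Data.Bool.Properties using (T-≡; T-not-≡; T-∧)
open import Data.Empty using (⊥; ⊥-elim)
open import Data.Integer as ℤ using (ℤ)
import Data.Integer.Properties as ℤ
open import Data.List
  using ( List; []; _∷_; [_]; length; filter; map; _++_; take; drop; reverse; upTo; concatMap
        ; cartesianProduct; cartesianProductWith )
import Data.List.Properties as List
open import Data.List.Membership.Propositional using (_∈_; _∉_; find; lose)
open import Data.List.Membership.Propositional.Properties
open import Data.List.Relation.Binary.Disjoint.Propositional using (Disjoint)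
open import Data.List.Relation.Binary.Pointwise as Pointwise using (Pointwise; []; _∷_)
open import Data.List.Relation.Binary.Sublist.Propositional
  using (_⊆_; []; _∷_; _∷ʳ_; ⊆-refl; ⊆-trans; minimum; from∈)
import Data.List.Relation.Binary.Sublist.Propositional.Properties as Sublist
open import Data.List.Relation.Unary.All as All using (All; []; _∷_)
import Data.List.Relation.Unary.All.Properties as All
open import Data.List.Relation.Unary.Any as Any using (Any; here; there)
open import Data.List.Relation.Unary.Any.Properties using (any⁺; any⁻; singleton⁻)
open import Data.List.Relation.Unary.Unique.Propositional using (Unique; []; _∷_)
import Data.List.Relation.Unary.Unique.Propositional.Properties as Unique
open import Data.List.Reverse using (Reverse; []; _∶_∶ʳ_; reverseView)
open import Data.Nat as ℕ using (zero; suc; _<_; z≤n; s≤s; _≟_; _≤?_; _<ᵇ_; _≡ᵇ_)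
open import Data.Nat.Induction using (<-rec)
import Data.Nat.Properties as ℕ
open import Data.List.Membership.DecPropositional ℕ._≟_ using (_∈?_)
open import Data.Product using (∃; ∃₂; _×_; _,_; proj₁; proj₂)
open import Data.Sum as Sum using (_⊎_; inj₁; inj₂)
open import Function using (_∘_; _$_; flip; Equivalence; _⇔_; mk⇔)
open import Relation.Binary.Definitions using (Tri; tri<; tri≈; tri>)
open import Relation.Binary.PropositionalEquality
  using (refl; sym; trans; cong; cong₂; subst; subst₂; _≢_; module ≡-Reasoning)
open import Relation.Nullary using (¬_; Dec; yes; no; does; ¬?)
open import Relation.Nullary.Decidable using (T?; dec-true; dec-false; _×-dec_)
open import Relation.Unary using (Decidable)

T-not : ∀ {b} → T (not b) ⇔ (¬ T b)
T-not {true}  = mk⇔ (λ ()) (λ ¬t → ¬t _)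
T-not {false} = mk⇔ (λ _ ()) (λ _ → _)

T-not-≡ᵇ : ∀ {x y} → T (not (x ≡ᵇ y)) ⇔ x ≢ y
T-not-≡ᵇ {x} {y} = mk⇔ (λ t x≡y → Equivalence.to T-not t (ℕ.≡⇒≡ᵇ x y x≡y))
                       (λ x≢y → Equivalence.from T-not (x≢y ∘ ℕ.≡ᵇ⇒≡ x y))

T-== : ∀ {a b} → T (a == b) ⇔ a ≡ b
T-== {true}  {true}  = mk⇔ (λ _ → refl) (λ _ → _)
T-== {true}  {false} = mk⇔ (λ ()) (λ ())
T-== {false} {true}  = mk⇔ (λ ()) (λ ())
T-== {false} {false} = mk⇔ (λ _ → refl) (λ _ → _)

<ᵇ-true : ∀ {m n} → m < n → (m <ᵇ n) ≡ true
<ᵇ-true = Equivalence.to T-≡ ∘ ℕ.<⇒<ᵇ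

<ᵇ-false : ∀ {m n} → n ≤ m → (m <ᵇ n) ≡ false
<ᵇ-false {m} {n} n≤m =
  Equivalence.to T-not-≡ (Equivalence.from T-not (λ m<n → ℕ.<⇒≱ (ℕ.<ᵇ⇒< m n m<n) n≤m))

module _ where
  open import Data.Integer using (_+_; _*_; -_; _-_)
  open import Data.Integer.Properties
    using ( +-comm; +-assoc; +-identityˡ; +-identityʳ; *-identityˡ; *-distribʳ-+
          ; neg-involutive; neg-distrib-+; neg-distribˡ-*; pos-+; +-commutativeSemigroup)
  open import Algebra.Properties.CommutativeSemigroup +-commutativeSemigroup
    using (interchange)
  open ≡-Reasoning

  sumBelow-cong : ∀ n {f g : ℕ → ℤ} → (∀ {i} → i < n → f i ≡ g i) →
                  sumBelow n f ≡ sumBelow n g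
  sumBelow-cong zero    f≗g = refl
  sumBelow-cong (suc n) f≗g =
    cong₂ _+_ (sumBelow-cong n (f≗g ∘ ℕ.m<n⇒m<1+n)) (f≗g ℕ.≤-refl)

  sumBelow-zero : ∀ n {f : ℕ → ℤ} → (∀ {i} → i < n → f i ≡ + 0) → sumBelow n f ≡ + 0
  sumBelow-zero zero    f≗0 = refl
  sumBelow-zero (suc n) f≗0 =
    cong₂ _+_ (sumBelow-zero n (f≗0 ∘ ℕ.m<n⇒m<1+n)) (f≗0 ℕ.≤-refl)

  sumBelow-distrib-+ : ∀ n (f g : ℕ → ℤ) →
                       sumBelow n (λ i → f i + g i) ≡ sumBelow n f + sumBelow n g
  sumBelow-distrib-+ zero    f g = refl
  sumBelow-distrib-+ (suc n) f g = trans
    (cong (_+ (f n + g n)) (sumBelow-distrib-+ n f g))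
    (interchange (sumBelow n f) (sumBelow n g) (f n) (g n))

  neg-sumBelow : ∀ n (f : ℕ → ℤ) → - sumBelow n f ≡ sumBelow n (λ i → - f i)
  neg-sumBelow zero    f = refl
  neg-sumBelow (suc n) f =
    trans (neg-distrib-+ (sumBelow n f) (f n)) (cong (_+ - f n) (neg-sumBelow n f))

  sumBelow-suc : ∀ n (f : ℕ → ℤ) → sumBelow (suc n) f ≡ f 0 + sumBelow n (f ∘ suc)
  sumBelow-suc zero    f = +-comm (+ 0) (f 0)
  sumBelow-suc (suc n) f = trans (cong (_+ f (suc n)) (sumBelow-suc n f))
                                 (+-assoc (f 0) (sumBelow n (f ∘ suc)) (f (suc n)))

  indicator : Bool → ℕ
  indicator b = if b then 1 else 0

  sumBelow-delta : ∀ {c} N → c < N → sumBelow N (λ a → + indicator (does (c ≟ a))) ≡ + 1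
  sumBelow-delta {c} (suc N) (s≤s c≤N) with ℕ.m≤n⇒m<n∨m≡n c≤N
  ... | inj₁ c<N = trans
    (cong₂ _+_ (sumBelow-delta N c<N) (cong (+_ ∘ indicator) (dec-false (c ≟ N) (ℕ.<⇒≢ c<N))))
    (+-identityʳ (+ 1))
  ... | inj₂ refl = cong₂ _+_
    (sumBelow-zero N (λ a<c → cong (+_ ∘ indicator) (dec-false (c ≟ _) (ℕ.>⇒≢ a<c))))
    (cong (+_ ∘ indicator) (dec-true (c ≟ c) refl))

  sumBelow-indicator : ∀ {Q : Set} (Q? : Dec Q) c N → (Q → c < N) →
                       sumBelow N (λ a → + indicator (does Q? ∧ does (c ≟ a))) ≡ + indicator (does Q?)
  sumBelow-indicator (yes q) c N c<N = sumBelow-delta N (c<N q)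
  sumBelow-indicator (no _)  c N _   = sumBelow-zero N (λ _ → refl)

  length-filter-∷ : ∀ {A : Set} {P : A → Set} (P? : Decidable P) x xs →
                    length (filter P? (x ∷ xs)) ≡ indicator (does (P? x)) ℕ.+ length (filter P? xs)
  length-filter-∷ P? x xs with does (P? x)
  ... | true  = refl
  ... | false = refl

  length-filter-by-fibres :
    ∀ {A : Set} {P : A → Set} (P? : Decidable P) (q : A → ℕ) N xs →
    (∀ {x} → x ∈ xs → P x → q x < N) →
    + length (filter P? xs) ≡ sumBelow N (λ a → + length (filter (λ x → P? x ×-dec q x ≟ a) xs))
  length-filter-by-fibres P? q N []       _   = sym (sumBelow-zero N (λ _ → refl))
  length-filter-by-fibres P? q N (x ∷ xs) q<N = begin
    + length (filter P? (x ∷ xs))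
      ≡⟨ cong +_ (length-filter-∷ P? x xs) ⟩
    + (indicator (does (P? x)) ℕ.+ length (filter P? xs))
      ≡⟨ pos-+ (indicator (does (P? x))) _ ⟩
    + indicator (does (P? x)) + + length (filter P? xs)
      ≡⟨ cong₂ _+_ (sym (sumBelow-indicator (P? x) (q x) N (q<N (here refl))))
                   (length-filter-by-fibres P? q N xs (q<N ∘ there)) ⟩
    sumBelow N (λ a → + indicator (does (Fibre a x))) + sumBelow N (λ a → + length (filter (Fibre a) xs))
      ≡⟨ sumBelow-distrib-+ N _ _ ⟨
    sumBelow N (λ a → + indicator (does (Fibre a x)) + + length (filter (Fibre a) xs))
      ≡⟨ sumBelow-cong N (λ {a} _ → trans (sym (pos-+ (indicator (does (Fibre a x))) _))
                                          (cong +_ (sym (length-filter-∷ (Fibre a) x xs)))) ⟩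
    sumBelow N (λ a → + length (filter (Fibre a) (x ∷ xs))) ∎
    where
    Fibre : ∀ a → Decidable _
    Fibre a x = P? x ×-dec q x ≟ a

  X-convolution : ∀ (B : Series) n → sumBelow (suc n) (λ i → X (suc i) * B (n ∸ i)) ≡ B n
  X-convolution B n = begin
    sumBelow (suc n) (λ i → X (suc i) * B (n ∸ i))
      ≡⟨ sumBelow-suc n _ ⟩
    + 1 * B n + sumBelow n (λ i → X (suc (suc i)) * B (n ∸ suc i))
      ≡⟨ cong₂ _+_ (*-identityˡ (B n)) (sumBelow-zero n (λ _ → refl)) ⟩
    B n + + 0
      ≡⟨ +-identityʳ (B n) ⟩
    B n ∎

  X⊗-suc : ∀ B n → (X ⊗ B) (suc n) ≡ B n
  X⊗-suc B n = trans (sumBelow-suc (suc n) _) (trans (+-identityˡ _) (X-convolution B n))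

  invT-stable : ∀ a N {m} → m ≤ N → invT a N m ≡ inv a m
  invT-stable a zero    z≤n = refl
  invT-stable a (suc N) m≤1+N with ℕ.m≤n⇒m<n∨m≡n m≤1+N
  ... | inj₁ (s≤s m≤N) rewrite Equivalence.to T-≡ (ℕ.≤⇒≤ᵇ m≤N) = invT-stable a N m≤N
  ... | inj₂ refl = refl

  inv-suc : ∀ a N → inv a (suc N) ≡ - sumBelow (suc N) (λ j → a (suc j) * inv a (N ∸ j))
  inv-suc a N rewrite <ᵇ-false {N} ℕ.≤-refl | Equivalence.to T-≡ (ℕ.≡⇒≡ᵇ N N refl) =
    cong -_ (sumBelow-cong (suc N) (λ {j} _ → cong (a (suc j) *_) (invT-stable a N (ℕ.m∸n≤m N j))))

  -- The coefficients of F = x + x F + H F from x¹ on.  K (suc j) solves this with H = K j,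
  -- since K (suc j) (1 - x - K j) = x.
  record KRecurrence (H F : Series) : Set where
    field
      at-one     : F 1 ≡ + 1
      at-suc-suc : ∀ n → F (suc (suc n)) ≡
                   F (suc n) + sumBelow (suc n) (λ i → H (suc i) * F (suc (n ∸ i)))

  open KRecurrence public

  K-recurrence : ∀ j → KRecurrence (K j) (K (suc j))
  K-recurrence j = record { at-one = X⊗-suc B 0 ; at-suc-suc = step }
    where
    D = (1s ⊖ X) ⊖ K j
    B = inv D

    negate-coefficient : ∀ x k b → - (((+ 0 - x) - k) * b) ≡ x * b + k * b
    negate-coefficient x k b = begin
      - (((+ 0 - x) - k) * b) ≡⟨ cong (λ c → - ((c - k) * b)) (+-identityˡ (- x)) ⟩
      - ((- x - k) * b)       ≡⟨ cong (λ c → - (c * b)) (neg-distrib-+ x k) ⟨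
      - (- (x + k) * b)       ≡⟨ cong -_ (neg-distribˡ-* (x + k) b) ⟨
      - - ((x + k) * b)       ≡⟨ neg-involutive _ ⟩
      (x + k) * b             ≡⟨ *-distribʳ-+ b x k ⟩
      x * b + k * b           ∎

    step : ∀ n → K (suc j) (suc (suc n)) ≡
           K (suc j) (suc n) + sumBelow (suc n) (λ i → K j (suc i) * K (suc j) (suc (n ∸ i)))
    step n = begin
      K (suc j) (suc (suc n))
        ≡⟨ X⊗-suc B (suc n) ⟩
      B (suc n)
        ≡⟨ inv-suc D n ⟩
      - sumBelow (suc n) (λ i → D (suc i) * B (n ∸ i))
        ≡⟨ neg-sumBelow (suc n) _ ⟩
      sumBelow (suc n) (λ i → - (D (suc i) * B (n ∸ i)))
        ≡⟨ sumBelow-cong (suc n) (λ {i} _ → negate-coefficient (X (suc i)) (K j (suc i)) (B (n ∸ i))) ⟩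
      sumBelow (suc n) (λ i → X (suc i) * B (n ∸ i) + K j (suc i) * B (n ∸ i))
        ≡⟨ sumBelow-distrib-+ (suc n) _ _ ⟩
      sumBelow (suc n) (λ i → X (suc i) * B (n ∸ i)) + sumBelow (suc n) (λ i → K j (suc i) * B (n ∸ i))
        ≡⟨ cong₂ _+_ (trans (X-convolution B n) (sym (X⊗-suc B n)))
                     (sumBelow-cong (suc n) (λ {i} _ → cong (K j (suc i) *_) (sym (X⊗-suc B (n ∸ i))))) ⟩
      K (suc j) (suc n) + sumBelow (suc n) (λ i → K j (suc i) * K (suc j) (suc (n ∸ i))) ∎

  KRecurrence-unique : ∀ {H H′ F G} → (∀ n → H (suc n) ≡ H′ (suc n)) →
                       KRecurrence H F → KRecurrence H′ G → ∀ n → F (suc n) ≡ G (suc n)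
  KRecurrence-unique {H} {H′} {F} {G} H≗H′ recF recG = <-rec _ agree
    where
    agree : ∀ n → (∀ {m} → m < n → F (suc m) ≡ G (suc m)) → F (suc n) ≡ G (suc n)
    agree zero    _  = trans (at-one recF) (sym (at-one recG))
    agree (suc n) ih = begin
      F (suc (suc n))
        ≡⟨ at-suc-suc recF n ⟩
      F (suc n) + sumBelow (suc n) (λ i → H (suc i) * F (suc (n ∸ i)))
        ≡⟨ cong₂ _+_ (ih ℕ.≤-refl) (sumBelow-cong (suc n) (λ {i} _ →
             cong₂ _*_ (H≗H′ i) (ih (s≤s (ℕ.m∸n≤m n i))))) ⟩
      G (suc n) + sumBelow (suc n) (λ i → H′ (suc i) * G (suc (n ∸ i)))
        ≡⟨ at-suc-suc recG n ⟨
      G (suc (suc n)) ∎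

open import Data.Nat using (_+_; _*_)

private
  variable
    A B : Set

Unique-++⁻ : ∀ (xs : List A) {ys} → Unique (xs ++ ys) → Unique xs × Unique ys × Disjoint xs ys
Unique-++⁻ []       u        = [] , u , λ ()
Unique-++⁻ (x ∷ xs) (x∉ ∷ u) with Unique-++⁻ xs u
... | uxs , uys , disjoint = All.++⁻ˡ xs x∉ ∷ uxs , uys , disjoint′
  where
  disjoint′ : Disjoint (x ∷ xs) _
  disjoint′ (here refl , v∈ys) = All.lookup (All.++⁻ʳ xs x∉) v∈ys refl
  disjoint′ (there v∈xs , v∈ys) = disjoint (v∈xs , v∈ys)

Unique-map⁺ : ∀ (f : A → B) {xs} → (∀ {x y} → x ∈ xs → y ∈ xs → f x ≡ f y → x ≡ y) →
              Unique xs → Unique (map f xs)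
Unique-map⁺ f f-inj []       = []
Unique-map⁺ f f-inj (x∉ ∷ u) =
  All.map⁺ (All.tabulate (λ y∈ fx≡fy → All.lookup x∉ y∈ (f-inj (here refl) (there y∈) fx≡fy)))
  ∷ Unique-map⁺ f (λ p q → f-inj (there p) (there q)) u

Unique-⊆ : ∀ {xs ys : List A} → xs ⊆ ys → Unique ys → Unique xs
Unique-⊆ []         []       = []
Unique-⊆ (_ ∷ʳ p)   (_ ∷ u)  = Unique-⊆ p u
Unique-⊆ (refl ∷ p) (y∉ ∷ u) = Sublist.All-resp-⊆ p y∉ ∷ Unique-⊆ p u

pair-⊆ : ∀ {xs : List A} → 2 ≤ length xs → ∃₂ λ x y → x ∷ y ∷ [] ⊆ xs
pair-⊆ {xs = x ∷ y ∷ zs} _ = x , y , refl ∷ refl ∷ minimum zs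
pair-⊆ {xs = _ ∷ []}     (s≤s ())

take-length-++ : ∀ (xs : List A) {ys} → take (length xs) (xs ++ ys) ≡ xs
take-length-++ []       = refl
take-length-++ (x ∷ xs) = cong (x ∷_) (take-length-++ xs)

no-member⇒[] : ∀ {xs : List A} → (∀ {x} → x ∉ xs) → xs ≡ []
no-member⇒[] {xs = []}    _   = refl
no-member⇒[] {xs = _ ∷ _} ∉xs = ⊥-elim (∉xs (here refl))

length≡0⇒[] : ∀ {xs : List A} → length xs ≡ 0 → xs ≡ []
length≡0⇒[] {xs = []} _ = refl

length≡1 : ∀ {xs : List A} → length xs ≡ 1 → ∃ λ x → xs ≡ [ x ]
length≡1 {xs = x ∷ []} _ = x , refl

length-≤-injection : ∀ (f : A → B) {xs ys} → Unique xs → (∀ {x} → x ∈ xs → f x ∈ ys) →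
                     (∀ {x y} → x ∈ xs → y ∈ xs → f x ≡ f y → x ≡ y) → length xs ≤ length ys
length-≤-injection f []                f∈ f-inj = z≤n
length-≤-injection f {x ∷ xs} (x∉ ∷ u) f∈ f-inj with ∈-∃++ (f∈ (here refl))
... | ys₁ , ys₂ , refl = ℕ.≤-trans
  (s≤s (length-≤-injection f u into-rest (λ p q → f-inj (there p) (there q))))
  (ℕ.≤-reflexive (sym (List.length-++-sucʳ ys₁ (f x) ys₂)))
  where
  into-rest : ∀ {z} → z ∈ xs → f z ∈ ys₁ ++ ys₂
  into-rest z∈ with ∈-++⁻ ys₁ (f∈ (there z∈))
  ... | inj₁ p             = ∈-++⁺ˡ p
  ... | inj₂ (here fz≡fx) = ⊥-elim (All.lookup x∉ z∈ (f-inj (here refl) (there z∈) (sym fz≡fx)))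
  ... | inj₂ (there p)    = ∈-++⁺ʳ ys₁ p

record ListBijection (xs : List A) (ys : List B) : Set where
  field
    to      : A → B
    from    : B → A
    to-∈    : ∀ {x} → x ∈ xs → to x ∈ ys
    from-∈  : ∀ {y} → y ∈ ys → from y ∈ xs
    from-to : ∀ {x} → x ∈ xs → from (to x) ≡ x
    to-from : ∀ {y} → y ∈ ys → to (from y) ≡ y

length-≡-bijection : ∀ {xs : List A} {ys : List B} → Unique xs → Unique ys →
                     ListBijection xs ys → length xs ≡ length ys
length-≡-bijection uxs uys bij = ℕ.≤-antisym
  (length-≤-injection to uxs to-∈ (λ p q e → trans (sym (from-to p)) (trans (cong from e) (from-to q))))
  (length-≤-injection from uys from-∈ (λ p q e → trans (sym (to-from p)) (trans (cong to e) (to-from q))))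
  where open ListBijection bij

length-cartesianProduct : ∀ (xs : List A) (ys : List B) →
                          length (cartesianProduct xs ys) ≡ length xs * length ys
length-cartesianProduct []       ys = refl
length-cartesianProduct (x ∷ xs) ys = trans (List.length-++ (map (x ,_) ys))
  (cong₂ _+_ (List.length-map (x ,_) ys) (length-cartesianProduct xs ys))

⊆-++⁻ : ∀ (u : List A) {v s} → s ⊆ u ++ v → ∃₂ λ s₁ s₂ → s ≡ s₁ ++ s₂ × s₁ ⊆ u × s₂ ⊆ v
⊆-++⁻ []      p          = [] , _ , refl , [] , p
⊆-++⁻ (x ∷ u) (.x ∷ʳ p) with ⊆-++⁻ u p
... | s₁ , s₂ , refl , p₁ , p₂ = s₁ , s₂ , refl , x ∷ʳ p₁ , p₂
⊆-++⁻ (x ∷ u) (refl ∷ p) with ⊆-++⁻ u p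
... | s₁ , s₂ , refl , p₁ , p₂ = x ∷ s₁ , s₂ , refl , refl ∷ p₁ , p₂

⊆-map⁻ : ∀ (f : A → B) σ {s} → s ⊆ map f σ → ∃ λ s′ → s ≡ map f s′ × s′ ⊆ σ
⊆-map⁻ f []      []          = [] , refl , []
⊆-map⁻ f (x ∷ σ) (_ ∷ʳ p) with ⊆-map⁻ f σ p
... | s′ , refl , p′ = s′ , refl , x ∷ʳ p′
⊆-map⁻ f (x ∷ σ) (refl ∷ p) with ⊆-map⁻ f σ p
... | s′ , refl , p′ = x ∷ s′ , refl , refl ∷ p′

∷ʳ-⊆-∷ʳ⁻ : ∀ {s α : List A} {y m} → s ++ [ y ] ⊆ α ++ [ m ] → (y ≡ m × s ⊆ α) ⊎ s ++ [ y ] ⊆ α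
∷ʳ-⊆-∷ʳ⁻ {s = s} {α = α} {y = y} {m = m} p
  with subst₂ _⊆_ (List.reverse-++ s [ y ]) (List.reverse-++ α [ m ]) (Sublist.reverse⁺ p)
... | refl ∷ q = inj₁ (refl , Sublist.reverse⁻ q)
... | _ ∷ʳ q   = inj₂ (Sublist.reverse⁻ (subst (_⊆ reverse α) (sym (List.reverse-++ s [ y ])) q))

Pointwise-++⁻ : ∀ {R : A → B → Set} ws xs {ys zs} → length ws ≡ length xs →
                Pointwise R (ws ++ ys) (xs ++ zs) → Pointwise R ws xs × Pointwise R ys zs
Pointwise-++⁻ []       []       _   rs       = [] , rs
Pointwise-++⁻ (w ∷ ws) (x ∷ xs) len (r ∷ rs) with Pointwise-++⁻ ws xs (ℕ.suc-injective len) rs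
... | left , right = r ∷ left , right

Pointwise-Any : ∀ {R : A → B → Set} {P : A → Set} {Q : B → Set} {xs ys} →
                (∀ {a b} → R a b → P a → Q b) → Pointwise R xs ys → Any P xs → Any Q ys
Pointwise-Any f (r ∷ _)  (here pa) = here (f r pa)
Pointwise-Any f (_ ∷ rs) (there a) = there (Pointwise-Any f rs a)

InRange : ℕ → ℕ → Set
InRange n v = 1 ≤ v × v ≤ n

record IsPerm (n : ℕ) (σ : List ℕ) : Set where
  constructor isPerm
  field
    length≡ : length σ ≡ n
    inRange : All (InRange n) σ
    unique  : Unique σ

open IsPerm public

range : ℕ → List ℕ
range n = map suc (upTo n)

∈-range⁻ : ∀ {n v} → v ∈ range n → InRange n v
∈-range⁻ v∈ with ∈-map⁻ suc v∈
... | i , i∈ , refl = s≤s z≤n , ∈-upTo⁻ i∈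

∈-range⁺ : ∀ {n v} → InRange n v → v ∈ range n
∈-range⁺ {v = suc i} (_ , v≤n) = ∈-map⁺ suc (∈-upTo⁺ v≤n)

Unique-range : ∀ n → Unique (range n)
Unique-range n = Unique.map⁺ ℕ.suc-injective (Unique.upTo⁺ n)

length-range : ∀ n → length (range n) ≡ n
length-range n = trans (List.length-map suc (upTo n)) (List.length-upTo n)

distinct⇔Unique : ∀ {xs} → T (distinct xs) ⇔ Unique xs
distinct⇔Unique = mk⇔ to from
  where
  to : ∀ {xs} → T (distinct xs) → Unique xs
  to {[]}     _ = []
  to {x ∷ xs} d with Equivalence.to T-∧ d
  ... | x-new , d′ = All.map (Equivalence.to T-not-≡ᵇ) (All.all⁺ _ xs x-new) ∷ to d′
  from : ∀ {xs} → Unique xs → T (distinct xs)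
  from []       = _
  from (x∉ ∷ u) = Equivalence.from T-∧ (All.all⁻ _ (All.map (Equivalence.from T-not-≡ᵇ) x∉) , from u)

words-suc : ∀ n m → words n (suc m) ≡ cartesianProductWith (flip _∷_) (words n m) (range n)
words-suc n m = go (words n m)
  where
  go : ∀ ws → concatMap (λ w → map (_∷ w) (range n)) ws ≡ cartesianProductWith (flip _∷_) ws (range n)
  go []       = refl
  go (w ∷ ws) = cong (map (_∷ w) (range n) ++_) (go ws)

∈-words⁻ : ∀ n m {w} → w ∈ words n m → length w ≡ m × All (InRange n) w
∈-words⁻ n zero    (here refl) = refl , []
∈-words⁻ n (suc m) w∈ rewrite words-suc n m
  with ∈-cartesianProductWith⁻ (flip _∷_) (words n m) (range n) w∈
... | w′ , v , w′∈ , v∈ , refl with ∈-words⁻ n m w′∈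
...   | len , bounded = cong suc len , ∈-range⁻ v∈ ∷ bounded

∈-words⁺ : ∀ n m {w} → length w ≡ m → All (InRange n) w → w ∈ words n m
∈-words⁺ n zero    {[]}    refl []        = here refl
∈-words⁺ n (suc m) {v ∷ w} len  (v∈ ∷ w∈) rewrite words-suc n m =
  ∈-cartesianProductWith⁺ (flip _∷_) (∈-words⁺ n m (ℕ.suc-injective len) w∈) (∈-range⁺ v∈)

Unique-words : ∀ n m → Unique (words n m)
Unique-words n zero    = [] ∷ []
Unique-words n (suc m) rewrite words-suc n m =
  Unique.cartesianProductWith⁺ (flip _∷_)
    (λ e → List.∷-injectiveʳ e , List.∷-injectiveˡ e) (Unique-words n m) (Unique-range n)

∈-perms⁻ : ∀ {n σ} → σ ∈ perms n → IsPerm n σ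
∈-perms⁻ {n} σ∈ with ∈-filter⁻ (T? ∘ distinct) σ∈
... | w∈ , d with ∈-words⁻ n n w∈
...   | len , bounded = isPerm len bounded (Equivalence.to distinct⇔Unique d)

∈-perms⁺ : ∀ {n σ} → IsPerm n σ → σ ∈ perms n
∈-perms⁺ {n} (isPerm len bounded u) =
  ∈-filter⁺ (T? ∘ distinct) (∈-words⁺ n n len bounded) (Equivalence.from distinct⇔Unique u)

Unique-perms : ∀ n → Unique (perms n)
Unique-perms n = Unique.filter⁺ (T? ∘ distinct) (Unique-words n n)

-- Otherwise σ would inject into the n - 1 letters of range n other than v.
IsPerm-∈ : ∀ {n σ v} → IsPerm n σ → InRange n v → v ∈ σ
IsPerm-∈ {n} {σ} {v} P v∈[1,n] with v ∈? σ
... | yes v∈σ = v∈σ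
... | no  v∉σ = ⊥-elim (ℕ.<-irrefl refl (ℕ.≤-<-trans n≤ <n))
  where
  others = filter (λ x → ¬? (x ≟ v)) (range n)
  n≤ : n ≤ length others
  n≤ = subst (_≤ length others) (length≡ P) (length-≤-injection (λ x → x) (unique P)
         (λ {x} x∈σ → ∈-filter⁺ (λ x → ¬? (x ≟ v)) (∈-range⁺ (All.lookup (inRange P) x∈σ))
                        (λ x≡v → v∉σ (subst (_∈ σ) x≡v x∈σ)))
         (λ _ _ e → e))
  <n : length others < n
  <n = subst (length others <_) (length-range n)
         (List.filter-notAll (λ x → ¬? (x ≟ v)) (range n)
                             (Any.map (λ v≡x x≢v → x≢v (sym v≡x)) (∈-range⁺ v∈[1,n])))

IsPerm-count-≤ : ∀ {n σ v} → IsPerm n σ → v ≤ n → length (filter (_≤? v) σ) ≡ v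
IsPerm-count-≤ {n} {σ} {v} P v≤n =
  trans (length-≡-bijection (Unique.filter⁺ (_≤? v) (unique P)) (Unique-range v) bij) (length-range v)
  where
  bij : ListBijection (filter (_≤? v) σ) (range v)
  bij = record
    { to      = λ x → x
    ; from    = λ x → x
    ; to-∈    = λ x∈ → let x∈σ , x≤v = ∈-filter⁻ (_≤? v) x∈ in
                       ∈-range⁺ (proj₁ (All.lookup (inRange P) x∈σ) , x≤v)
    ; from-∈  = λ x∈ → let 1≤x , x≤v = ∈-range⁻ x∈ in
                       ∈-filter⁺ (_≤? v) (IsPerm-∈ P (1≤x , ℕ.≤-trans x≤v v≤n)) x≤v
    ; from-to = λ _ → refl
    ; to-from = λ _ → refl
    }

SameComparison : ℕ → ℕ → ℕ → ℕ → Set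
SameComparison p q x y = (p <ᵇ q) ≡ (x <ᵇ y)

SameComparison-< : ∀ {p q x y} → SameComparison p q x y → p < q → x < y
SameComparison-< {x = x} {y} eq p<q = ℕ.<ᵇ⇒< x y (subst T eq (ℕ.<⇒<ᵇ p<q))

SameComparison-≥ : ∀ {p q x y} → SameComparison p q x y → q ≤ p → y ≤ x
SameComparison-≥ eq q≤p = ℕ.≮⇒≥ (λ x<y → ℕ.<⇒≱ (SameComparison-< (sym eq) x<y) q≤p)

sameComparison : ∀ {p q x y} → (p < q → x < y) → (x < y → p < q) → SameComparison p q x y
sameComparison {p} {q} {x} {y} to from with p <ᵇ q in p<ᵇq | x <ᵇ y in x<ᵇy
... | true  | true  = refl
... | false | false = refl
... | true  | false = ⊥-elim (subst T x<ᵇy (ℕ.<⇒<ᵇ (to (ℕ.<ᵇ⇒< p q (subst T (sym p<ᵇq) _)))))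
... | false | true  = ⊥-elim (subst T p<ᵇq (ℕ.<⇒<ᵇ (from (ℕ.<ᵇ⇒< x y (subst T (sym x<ᵇy) _)))))

sameFirst⇒Pointwise : ∀ {p x} π s → T (sameFirst p x π s) →
                      Pointwise (λ q y → SameComparison p q x y) π s
sameFirst⇒Pointwise []      []      _ = []
sameFirst⇒Pointwise (q ∷ π) (y ∷ s) t with Equivalence.to T-∧ t
... | first , rest = Equivalence.to T-== first ∷ sameFirst⇒Pointwise π s rest

Pointwise⇒sameFirst : ∀ {p x π s} → Pointwise (λ q y → SameComparison p q x y) π s →
                      T (sameFirst p x π s)
Pointwise⇒sameFirst []       = _
Pointwise⇒sameFirst (r ∷ rs) = Equivalence.from T-∧ (Equivalence.from T-== r , Pointwise⇒sameFirst rs)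

sameOrder-length : ∀ π s → T (sameOrder π s) → length π ≡ length s
sameOrder-length []      []      _ = refl
sameOrder-length (p ∷ π) (x ∷ s) t = cong suc (sameOrder-length π s (proj₂ (Equivalence.to T-∧ t)))

sameOrder-∷ʳ⁻ : ∀ π s {l y} → T (sameOrder (π ++ [ l ]) (s ++ [ y ])) →
                T (sameOrder π s) × Pointwise (λ p x → SameComparison p l x y) π s
sameOrder-∷ʳ⁻ π s {l} {y} t = go π s (∷ʳ-length-injective (sameOrder-length (π ++ [ l ]) (s ++ [ y ]) t)) t
  where
  ∷ʳ-length-injective : length (π ++ [ l ]) ≡ length (s ++ [ y ]) → length π ≡ length s
  ∷ʳ-length-injective e =
    ℕ.+-cancelʳ-≡ 1 (length π) (length s) (trans (sym (List.length-++ π)) (trans e (List.length-++ s)))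
  go : ∀ π s → length π ≡ length s → T (sameOrder (π ++ [ l ]) (s ++ [ y ])) →
       T (sameOrder π s) × Pointwise (λ p x → SameComparison p l x y) π s
  go []      []      _   _ = _ , []
  go (p ∷ π) (x ∷ s) len t with Equivalence.to T-∧ t
  ... | first , rest
    with go π s (ℕ.suc-injective len) rest
       | Pointwise-++⁻ π s (ℕ.suc-injective len) (sameFirst⇒Pointwise (π ++ [ l ]) (s ++ [ y ]) first)
  ...  | iso , agree | first′ , (r ∷ []) = Equivalence.from T-∧ (Pointwise⇒sameFirst first′ , iso) , r ∷ agree

sameOrder-∷ʳ⁺ : ∀ {π s l y} → T (sameOrder π s) → Pointwise (λ p x → SameComparison p l x y) π s →
                T (sameOrder (π ++ [ l ]) (s ++ [ y ]))
sameOrder-∷ʳ⁺                   _ []       = _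
sameOrder-∷ʳ⁺ {p ∷ π} {x ∷ s} t (r ∷ rs) with Equivalence.to T-∧ t
... | first , iso = Equivalence.from T-∧
  (Pointwise⇒sameFirst (Pointwise.++⁺ (sameFirst⇒Pointwise π s first) (r ∷ [])) , sameOrder-∷ʳ⁺ iso rs)

sameOrder-∷ʳ-view : ∀ π {l} s → T (sameOrder (π ++ [ l ]) s) → ∃₂ λ s₀ y → s ≡ s₀ ++ [ y ]
sameOrder-∷ʳ-view π s t with reverseView s
sameOrder-∷ʳ-view []      _ () | []
sameOrder-∷ʳ-view (_ ∷ _) _ () | []
... | s₀ ∶ _ ∶ʳ y = s₀ , y , refl

OrderPreservingOn : (ℕ → ℕ) → List ℕ → Set
OrderPreservingOn f σ = ∀ {x y} → x ∈ σ → y ∈ σ → SameComparison (f x) (f y) x y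

sameFirst-map : ∀ (f : ℕ → ℕ) {p x} π s → (∀ {y} → y ∈ s → SameComparison (f x) (f y) x y) →
                sameFirst p (f x) π (map f s) ≡ sameFirst p x π s
sameFirst-map f []      []      _ = refl
sameFirst-map f []      (_ ∷ _) _ = refl
sameFirst-map f (_ ∷ _) []      _ = refl
sameFirst-map f {p} {x} (q ∷ π) (y ∷ s) h rewrite h (here refl) =
  cong (((p <ᵇ q) == (x <ᵇ y)) ∧_) (sameFirst-map f π s (h ∘ there))

sameOrder-map : ∀ (f : ℕ → ℕ) π s → OrderPreservingOn f s → sameOrder π (map f s) ≡ sameOrder π s
sameOrder-map f []      []      _ = refl
sameOrder-map f []      (_ ∷ _) _ = refl
sameOrder-map f (_ ∷ _) []      _ = refl
sameOrder-map f (p ∷ π) (x ∷ s) h = cong₂ _∧_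
  (sameFirst-map f π s (h (here refl) ∘ there))
  (sameOrder-map f π s (λ x∈ y∈ → h (there x∈) (there y∈)))

IncreasingOn : (ℕ → ℕ) → List ℕ → Set
IncreasingOn f σ = ∀ {x y} → x ∈ σ → y ∈ σ → x < y → f x < f y

increasing⇒OrderPreserving : ∀ {f σ} → IncreasingOn f σ → OrderPreservingOn f σ
increasing⇒OrderPreserving {f} inc {x} {y} x∈ y∈ = sameComparison (ℕ.≰⇒> ∘ not-below) (inc x∈ y∈)
  where
  not-below : f x < f y → ¬ y ≤ x
  not-below fx<fy y≤x with ℕ.m≤n⇒m<n∨m≡n y≤x
  ... | inj₁ y<x  = ℕ.<-asym fx<fy (inc y∈ x∈ y<x)
  ... | inj₂ refl = ℕ.<-irrefl refl fx<fy

increasing⇒injective : ∀ {f σ} → IncreasingOn f σ → ∀ {x y} → x ∈ σ → y ∈ σ → f x ≡ f y → x ≡ y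
increasing⇒injective inc {x} {y} x∈ y∈ fx≡fy with ℕ.<-cmp x y
... | tri< x<y _ _ = ⊥-elim (ℕ.<-irrefl fx≡fy (inc x∈ y∈ x<y))
... | tri≈ _ x≡y _ = x≡y
... | tri> _ _ y<x = ⊥-elim (ℕ.<-irrefl (sym fx≡fy) (inc y∈ x∈ y<x))

sameOrder-1243 : ∀ {w x y z} → w < x → x < z → z < y → T (sameOrder (1 ∷ 2 ∷ 4 ∷ 3 ∷ []) (w ∷ x ∷ y ∷ z ∷ []))
sameOrder-1243 w<x x<z z<y
  rewrite <ᵇ-true w<x | <ᵇ-true (ℕ.<-trans w<x (ℕ.<-trans x<z z<y)) | <ᵇ-true (ℕ.<-trans w<x x<z)
        | <ᵇ-true (ℕ.<-trans x<z z<y) | <ᵇ-true x<z | <ᵇ-false (ℕ.<⇒≤ z<y) = _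

sameOrder-2143 : ∀ {w x y z} → x < w → w < z → z < y → T (sameOrder (2 ∷ 1 ∷ 4 ∷ 3 ∷ []) (w ∷ x ∷ y ∷ z ∷ []))
sameOrder-2143 x<w w<z z<y
  rewrite <ᵇ-false (ℕ.<⇒≤ x<w) | <ᵇ-true (ℕ.<-trans w<z z<y) | <ᵇ-true w<z
        | <ᵇ-true (ℕ.<-trans x<w (ℕ.<-trans w<z z<y)) | <ᵇ-true (ℕ.<-trans x<w w<z) | <ᵇ-false (ℕ.<⇒≤ z<y) = _

∈-subseqs⁻ : ∀ σ {s} → s ∈ subseqs σ → s ⊆ σ
∈-subseqs⁻ []      (here refl) = []
∈-subseqs⁻ (x ∷ σ) s∈ with ∈-++⁻ (map (x ∷_) (subseqs σ)) s∈
... | inj₂ s∈′ = x ∷ʳ ∈-subseqs⁻ σ s∈′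
... | inj₁ s∈′ with ∈-map⁻ (x ∷_) s∈′
...   | s′ , s′∈ , refl = refl ∷ ∈-subseqs⁻ σ s′∈

∈-subseqs⁺ : ∀ {s σ} → s ⊆ σ → s ∈ subseqs σ
∈-subseqs⁺ []                          = here refl
∈-subseqs⁺ (_∷ʳ_ {ys = σ} y s⊆σ) = ∈-++⁺ʳ (map (y ∷_) (subseqs σ)) (∈-subseqs⁺ s⊆σ)
∈-subseqs⁺ (refl ∷ s⊆σ)                = ∈-++⁺ˡ (∈-map⁺ _ (∈-subseqs⁺ s⊆σ))

record Contains (σ π : List ℕ) : Set where
  constructor occurrence
  field
    {letters} : List ℕ
    sublist   : letters ⊆ σ
    isoOrder  : T (sameOrder π letters)

contains⇔Contains : ∀ {σ π} → T (contains σ π) ⇔ Contains σ π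
contains⇔Contains {σ} {π} = mk⇔
  (λ c → let _ , s∈ , iso = find (any⁻ (sameOrder π) (subseqs σ) c) in occurrence (∈-subseqs⁻ σ s∈) iso)
  (λ (occurrence s⊆σ iso) → any⁺ (sameOrder π) (lose (∈-subseqs⁺ s⊆σ) iso))

Contains-⊆ : ∀ {τ σ π} → τ ⊆ σ → Contains τ π → Contains σ π
Contains-⊆ τ⊆σ (occurrence s⊆τ iso) = occurrence (⊆-trans s⊆τ τ⊆σ) iso

Contains-map⁻ : ∀ {f σ π} → OrderPreservingOn f σ → Contains (map f σ) π → Contains σ π
Contains-map⁻ {f} {σ} {π} f-mono (occurrence s⊆ iso) with ⊆-map⁻ f σ s⊆
... | s′ , refl , s′⊆σ = occurrence s′⊆σ (subst T (sameOrder-map f π s′ f-mono′) iso)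
  where
  f-mono′ : OrderPreservingOn f s′
  f-mono′ x∈ y∈ = f-mono (Sublist.Any-resp-⊆ s′⊆σ x∈) (Sublist.Any-resp-⊆ s′⊆σ y∈)

Contains-map⁺ : ∀ {f σ π} → OrderPreservingOn f σ → Contains σ π → Contains (map f σ) π
Contains-map⁺ {f} {σ} {π} f-mono (occurrence {s} s⊆σ iso) =
  occurrence (Sublist.map⁺ f s⊆σ) (subst T (sym (sameOrder-map f π s f-mono′)) iso)
  where
  f-mono′ : OrderPreservingOn f s
  f-mono′ x∈ y∈ = f-mono (Sublist.Any-resp-⊆ s⊆σ x∈) (Sublist.Any-resp-⊆ s⊆σ y∈)

Contains-init : ∀ {α m π l} → Contains (α ++ [ m ]) (π ++ [ l ]) → Contains α π
Contains-init {π = π} (occurrence {s} s⊆ iso) with sameOrder-∷ʳ-view π s iso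
... | s₀ , y , refl with ∷ʳ-⊆-∷ʳ⁻ s⊆
...   | inj₁ (_ , s₀⊆α) = occurrence s₀⊆α (proj₁ (sameOrder-∷ʳ⁻ π s₀ iso))
...   | inj₂ s⊆α        = occurrence (⊆-trans (Sublist.++⁺ʳ [ y ] ⊆-refl) s⊆α) (proj₁ (sameOrder-∷ʳ⁻ π s₀ iso))

Contains-∷ʳ-max⁺ : ∀ {α m π l} → All (_< m) α → All (_< l) π →
                   Contains α π → Contains (α ++ [ m ]) (π ++ [ l ])
Contains-∷ʳ-max⁺ {α} {m} {π} {l} α<m π<l (occurrence {s} s⊆α iso) =
  occurrence (Sublist.++⁺ s⊆α ⊆-refl) $
  sameOrder-∷ʳ⁺ iso (both-below π s (sameOrder-length π s iso) π<l (Sublist.All-resp-⊆ s⊆α α<m))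
  where
  both-below : ∀ π s → length π ≡ length s → All (_< l) π → All (_< m) s →
               Pointwise (λ p x → SameComparison p l x m) π s
  both-below []      []      _   _          _          = []
  both-below (_ ∷ π) (_ ∷ s) len (p<l ∷ ps) (x<m ∷ xs) =
    sameComparison (λ _ → x<m) (λ _ → p<l) ∷ both-below π s (ℕ.suc-injective len) ps xs

Contains-∷ʳ-max⁻ : ∀ {α m π l} → All (_< m) α → Any (l <_) π →
                   Contains (α ++ [ m ]) (π ++ [ l ]) → Contains α (π ++ [ l ])
Contains-∷ʳ-max⁻ {π = π} α<m l<π (occurrence {s} s⊆ iso) with sameOrder-∷ʳ-view π s iso
... | s₀ , y , refl with ∷ʳ-⊆-∷ʳ⁻ s⊆
...   | inj₂ s⊆α          = occurrence s⊆α iso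
...   | inj₁ (refl , s₀⊆α) with find (Pointwise-Any (λ r l<p → SameComparison-≥ r (ℕ.<⇒≤ l<p))
                                                   (proj₂ (sameOrder-∷ʳ⁻ π s₀ iso)) l<π)
...     | x , x∈s₀ , m≤x = ⊥-elim (ℕ.<⇒≱ (All.lookup α<m (Sublist.Any-resp-⊆ s₀⊆α x∈s₀)) m≤x)

Contains-∷-max⁻ : ∀ {τ m p π} → All (_< m) τ → Any (p <_) π →
                  Contains (m ∷ τ) (p ∷ π) → Contains τ (p ∷ π)
Contains-∷-max⁻ τ<m p<π (occurrence (_ ∷ʳ s⊆τ) iso) = occurrence s⊆τ iso
Contains-∷-max⁻ {π = π} τ<m p<π (occurrence {m ∷ s} (refl ∷ s⊆τ) iso)
  with find (Pointwise-Any SameComparison-< (sameFirst⇒Pointwise π s (proj₁ (Equivalence.to T-∧ iso))) p<π)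
... | x , x∈s , m<x = ⊥-elim (ℕ.<-asym m<x (All.lookup τ<m (Sublist.Any-resp-⊆ s⊆τ x∈s)))

record EndsAboveFirstTwo (π : List ℕ) : Set where
  constructor endsAboveFirstTwo
  field
    {first second last} : ℕ
    {middle}            : List ℕ
    shape               : π ≡ first ∷ second ∷ middle ++ [ last ]
    first<last          : first < last
    second<last         : second < last

low-end⇒two-low-in-prefix : ∀ {π b s₁ t z} → EndsAboveFirstTwo π → T (sameOrder π (s₁ ++ t ++ [ z ])) →
                               z ≤ b → Any (b <_) s₁ → 2 ≤ length (filter (_≤? b) s₁)
low-end⇒two-low-in-prefix {b = b} {s₁} {t} {z} (endsAboveFirstTwo {p} {q} {l} {π′} refl p<l q<l) iso z≤b =
  go s₁ (proj₂ (sameOrder-∷ʳ⁻ (p ∷ q ∷ π′) (s₁ ++ t) iso′))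
  where
  iso′ : T (sameOrder (p ∷ q ∷ π′ ++ [ l ]) ((s₁ ++ t) ++ [ z ]))
  iso′ = subst (T ∘ sameOrder (p ∷ q ∷ π′ ++ [ l ])) (sym (List.++-assoc s₁ t [ z ])) iso
  below : ∀ {a x} → SameComparison a l x z → a < l → x ≤ b
  below r a<l = ℕ.<⇒≤ (ℕ.<-≤-trans (SameComparison-< r a<l) z≤b)
  go : ∀ s₁ → Pointwise (λ a x → SameComparison a l x z) (p ∷ q ∷ π′) (s₁ ++ t) →
       Any (b <_) s₁ → 2 ≤ length (filter (_≤? b) s₁)
  go (x ∷ [])    (r ∷ _)        (here b<x) = ⊥-elim (ℕ.<⇒≱ b<x (below r p<l))
  go (x ∷ y ∷ _) (r₁ ∷ r₂ ∷ _) _          = subst (2 ≤_) (sym (cong length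
    (trans (List.filter-accept (_≤? b) (below r₁ p<l))
           (cong (x ∷_) (List.filter-accept (_≤? b) (below r₂ q<l)))))) (s≤s (s≤s z≤n))

-- An occurrence reaching into δ lies in e ∷ δ unless its part in u has a letter above b,
-- and then it would need two letters ≤ b in u.
Contains-split-at-threshold : ∀ {b e u δ π} → EndsAboveFirstTwo π →
  filter (_≤? b) u ≡ [ e ] → All (_≤ b) δ →
  Contains (u ++ δ) π → Contains u π ⊎ Contains (e ∷ δ) π
Contains-split-at-threshold {b} {e} {u} {δ} {π} shape u-low δ≤b (occurrence s⊆ iso) with ⊆-++⁻ u s⊆
... | s₁ , s₂ , refl , s₁⊆u , s₂⊆δ = split (reverseView s₂) iso s₂⊆δ
  where
  low-part-of-u : filter (_≤? b) s₁ ⊆ [ e ]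
  low-part-of-u = subst (filter (_≤? b) s₁ ⊆_) u-low (Sublist.filter⁺ (_≤? b) (_≤? b) (λ { refl x → x }) s₁⊆u)
  split : ∀ {s₂} → Reverse s₂ → T (sameOrder π (s₁ ++ s₂)) → s₂ ⊆ δ → Contains u π ⊎ Contains (e ∷ δ) π
  split []             iso _    = inj₁ (occurrence s₁⊆u (subst (T ∘ sameOrder π) (List.++-identityʳ s₁) iso))
  split (t ∶ _ ∶ʳ z) iso s₂⊆δ with All.all? (_≤? b) s₁
  ... | yes s₁≤b = inj₂ (occurrence
                         (Sublist.++⁺ (subst (_⊆ [ e ]) (List.filter-all (_≤? b) s₁≤b) low-part-of-u) s₂⊆δ) iso)
  ... | no ¬s₁≤b = ⊥-elim (ℕ.<⇒≱ (low-end⇒two-low-in-prefix shape iso z≤b high)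
                                  (Sublist.length-mono-≤ low-part-of-u))
    where
    z≤b : z ≤ b
    z≤b = All.lookup (Sublist.All-resp-⊆ s₂⊆δ δ≤b) (∈-++⁺ʳ t (here refl))
    high : Any (b <_) s₁
    high = Any.map ℕ.≰⇒> (All.¬All⇒Any¬ (_≤? b) s₁ ¬s₁≤b)

Avoids : List (List ℕ) → List ℕ → Set
Avoids R σ = All (λ π → ¬ Contains σ π) R

avoidsAll⇔Avoids : ∀ {R σ} → T (avoidsAll R σ) ⇔ Avoids R σ
avoidsAll⇔Avoids {R} {σ} = mk⇔
  (λ t → All.map (λ t′ c → Equivalence.to T-not t′ (Equivalence.from contains⇔Contains c))
                 (All.all⁺ (λ π → not (contains σ π)) R t))
  (λ av → All.all⁻ (λ π → not (contains σ π))
            (All.map (λ ¬c → Equivalence.from T-not (¬c ∘ Equivalence.to contains⇔Contains)) av))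

Avoids-⊆ : ∀ {R τ σ} → τ ⊆ σ → Avoids R σ → Avoids R τ
Avoids-⊆ τ⊆σ = All.map (λ ¬c → ¬c ∘ Contains-⊆ τ⊆σ)

Avoids-map : ∀ {R f σ} → OrderPreservingOn f σ → Avoids R (map f σ) ⇔ Avoids R σ
Avoids-map f-mono = mk⇔ (All.map (λ ¬c → ¬c ∘ Contains-map⁺ f-mono))
                        (All.map (λ ¬c → ¬c ∘ Contains-map⁻ f-mono))

pat2134-suc : ∀ i → pat2134 (3 + i) ≡ pat2134 (2 + i) ++ [ 3 + i ]
pat2134-suc i = cong (λ π → 2 ∷ 1 ∷ π) (begin
  map (_+ 3) (upTo (suc i))            ≡⟨ cong (map (_+ 3)) (List.upTo-∷ʳ i) ⟨
  map (_+ 3) (upTo i ++ [ i ])         ≡⟨ List.map-++ (_+ 3) (upTo i) [ i ] ⟩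
  map (_+ 3) (upTo i) ++ [ i + 3 ]     ≡⟨ cong (λ l → map (_+ 3) (upTo i) ++ [ l ]) (ℕ.+-comm i 3) ⟩
  map (_+ 3) (upTo i) ++ [ 3 + i ]     ∎)
  where open ≡-Reasoning

pat2134-below : ∀ i → All (_< 3 + i) (pat2134 (2 + i))
pat2134-below i = s≤s (s≤s (s≤s z≤n)) ∷ s≤s (s≤s z≤n) ∷ All.tabulate below
  where
  below : ∀ {x} → x ∈ map (_+ 3) (upTo i) → x < 3 + i
  below x∈ with ∈-map⁻ (_+ 3) x∈
  ... | j , j∈ , refl = subst (_< 3 + i) (ℕ.+-comm 3 j) (ℕ.+-monoʳ-< 3 (∈-upTo⁻ j∈))

-- For k = 1 and k = 2 the pattern 2134⋯k is 21, so Rk 1 and Rk 2 coincide.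
Avoids-∷ʳ-max : ∀ {k α m} → 2 ≤ k → All (_< m) α → Avoids (Rk k) (α ++ [ m ]) ⇔ Avoids (Rk (k ∸ 1)) α
Avoids-∷ʳ-max {k} {α} {m} 2≤k α<m = mk⇔
  (λ { (¬1243 ∷ ¬2143 ∷ ¬2134 ∷ []) →
       (λ c → ¬1243 (extend c)) ∷ (λ c → ¬2143 (extend c)) ∷ (λ c → ¬2134 (grow 2≤k c)) ∷ [] })
  (λ { (¬1243 ∷ ¬2143 ∷ ¬2134 ∷ []) →
       (λ c → ¬1243 (Contains-∷ʳ-max⁻ {π = 1 ∷ 2 ∷ 4 ∷ []} {3} α<m 3<4 c))
     ∷ (λ c → ¬2143 (Contains-∷ʳ-max⁻ {π = 2 ∷ 1 ∷ 4 ∷ []} {3} α<m 3<4 c))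
     ∷ (λ c → ¬2134 (shrink 2≤k c))
     ∷ [] })
  where
  3<4 : ∀ {p q} → Any (3 <_) (p ∷ q ∷ 4 ∷ [])
  3<4 = there (there (here ℕ.≤-refl))
  extend : ∀ {π} → Contains α π → Contains (α ++ [ m ]) π
  extend = Contains-⊆ (Sublist.++⁺ʳ [ m ] ⊆-refl)
  grow : ∀ {k} → 2 ≤ k → Contains α (pat2134 (k ∸ 1)) → Contains (α ++ [ m ]) (pat2134 k)
  grow (s≤s (s≤s {n = zero} _))  = extend
  grow (s≤s (s≤s {n = suc i} _)) rewrite pat2134-suc i = Contains-∷ʳ-max⁺ α<m (pat2134-below i)
  shrink : ∀ {k} → 2 ≤ k → Contains (α ++ [ m ]) (pat2134 k) → Contains α (pat2134 (k ∸ 1))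
  shrink (s≤s (s≤s {n = zero} _))  = Contains-∷ʳ-max⁻ {π = 2 ∷ []} {1} α<m (here (s≤s (s≤s z≤n)))
  shrink (s≤s (s≤s {n = suc i} _)) rewrite pat2134-suc i = Contains-init {π = pat2134 (2 + i)} {3 + i}

Avoids-∷-max : ∀ {k τ m} → 3 ≤ k → All (_< m) τ → Avoids (Rk k) τ → Avoids (Rk k) (m ∷ τ)
Avoids-∷-max (s≤s (s≤s (s≤s _))) τ<m (¬1243 ∷ ¬2143 ∷ ¬2134 ∷ []) =
    (λ c → ¬1243 (Contains-∷-max⁻ τ<m (here (s≤s (s≤s z≤n))) c))
  ∷ (λ c → ¬2143 (Contains-∷-max⁻ τ<m (there (here (s≤s (s≤s (s≤s z≤n))))) c))
  ∷ (λ c → ¬2134 (Contains-∷-max⁻ τ<m (there (here (s≤s (s≤s (s≤s z≤n))))) c))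
  ∷ []

Rk-EndsAboveFirstTwo : ∀ {k} → 3 ≤ k → All EndsAboveFirstTwo (Rk k)
Rk-EndsAboveFirstTwo (s≤s (s≤s (s≤s {n = i} _))) =
    endsAboveFirstTwo {last = 3} {middle = 4 ∷ []} refl (s≤s (s≤s z≤n)) (s≤s (s≤s (s≤s z≤n)))
  ∷ endsAboveFirstTwo {last = 3} {middle = 4 ∷ []} refl (s≤s (s≤s (s≤s z≤n))) (s≤s (s≤s z≤n))
  ∷ endsAboveFirstTwo (pat2134-suc i) (s≤s (s≤s (s≤s z≤n))) (s≤s (s≤s z≤n))
  ∷ []

-- Avoiders by the position of their maximum

Av : List (List ℕ) → ℕ → List (List ℕ)
Av R n = filter (λ σ → T? (avoidsAll R σ)) (perms n)

posOf : ℕ → List ℕ → ℕ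
posOf x []      = 0
posOf x (y ∷ σ) = if does (y ≟ x) then 0 else suc (posOf x σ)

AvAt : List (List ℕ) → ℕ → ℕ → List (List ℕ)
AvAt R n a = filter (λ σ → T? (avoidsAll R σ) ×-dec posOf n σ ≟ a) (perms n)

∈-Av⁻ : ∀ {R n σ} → σ ∈ Av R n → IsPerm n σ × Avoids R σ
∈-Av⁻ {R} σ∈ with ∈-filter⁻ (λ σ → T? (avoidsAll R σ)) σ∈
... | σ∈perms , av = ∈-perms⁻ σ∈perms , Equivalence.to avoidsAll⇔Avoids av

∈-Av⁺ : ∀ {R n σ} → IsPerm n σ → Avoids R σ → σ ∈ Av R n
∈-Av⁺ {R} P av = ∈-filter⁺ (λ σ → T? (avoidsAll R σ)) (∈-perms⁺ P) (Equivalence.from avoidsAll⇔Avoids av)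

Unique-Av : ∀ R n → Unique (Av R n)
Unique-Av R n = Unique.filter⁺ (λ σ → T? (avoidsAll R σ)) (Unique-perms n)

∈-AvAt⁻ : ∀ {R n a σ} → σ ∈ AvAt R n a → IsPerm n σ × Avoids R σ × posOf n σ ≡ a
∈-AvAt⁻ {R} {n} {a} σ∈ with ∈-filter⁻ (λ σ → T? (avoidsAll R σ) ×-dec posOf n σ ≟ a) σ∈
... | σ∈perms , av , pos≡a = ∈-perms⁻ σ∈perms , Equivalence.to avoidsAll⇔Avoids av , pos≡a

∈-AvAt⁺ : ∀ {R n a σ} → IsPerm n σ → Avoids R σ → posOf n σ ≡ a → σ ∈ AvAt R n a
∈-AvAt⁺ {R} {n} {a} P av pos≡a =
  ∈-filter⁺ (λ σ → T? (avoidsAll R σ) ×-dec posOf n σ ≟ a) (∈-perms⁺ P)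
            (Equivalence.from avoidsAll⇔Avoids av , pos≡a)

Unique-AvAt : ∀ R n a → Unique (AvAt R n a)
Unique-AvAt R n a = Unique.filter⁺ (λ σ → T? (avoidsAll R σ) ×-dec posOf n σ ≟ a) (Unique-perms n)

posOf-++ : ∀ {x} γ {δ} → x ∉ γ → posOf x (γ ++ x ∷ δ) ≡ length γ
posOf-++ {x} []      _  rewrite dec-true (x ≟ x) refl = refl
posOf-++ {x} (y ∷ γ) x∉ rewrite dec-false (y ≟ x) (λ y≡x → x∉ (here (sym y≡x))) =
  cong suc (posOf-++ γ (x∉ ∘ there))

IsPerm-split : ∀ {n σ v} → IsPerm n σ → InRange n v →
               ∃₂ λ γ δ → σ ≡ γ ++ v ∷ δ × posOf v σ ≡ length γ
IsPerm-split P v∈ with ∈-∃++ (IsPerm-∈ P v∈)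
... | γ , δ , refl =
  γ , δ , refl , posOf-++ γ (λ v∈γ → proj₂ (proj₂ (Unique-++⁻ γ (unique P))) (v∈γ , here refl))

AvAt-split : ∀ {R n a σ} → 1 ≤ n → σ ∈ AvAt R n a → ∃₂ λ γ δ → σ ≡ γ ++ n ∷ δ × length γ ≡ a
AvAt-split {R} {n} 1≤n σ∈ with ∈-AvAt⁻ {R} σ∈
... | P , _ , pos≡a with IsPerm-split {v = n} P (1≤n , ℕ.≤-refl)
...   | γ , δ , refl , pos≡len = γ , δ , refl , trans (sym pos≡len) pos≡a

avCount-by-position : ∀ R N → + avCount R (suc N) ≡ sumBelow (suc N) (λ a → + length (AvAt R (suc N) a))
avCount-by-position R N =
  length-filter-by-fibres (λ σ → T? (avoidsAll R σ)) (posOf (suc N)) (suc N) (perms (suc N)) position<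
  where
  position< : ∀ {σ} → σ ∈ perms (suc N) → _ → posOf (suc N) σ < suc N
  position< σ∈ _ with ∈-perms⁻ σ∈
  ... | P with IsPerm-split {v = suc N} P (s≤s z≤n , ℕ.≤-refl)
  ...   | γ , δ , refl , pos≡len = subst₂ _<_ (sym pos≡len) (length≡ P)
          (subst (length γ <_) (sym (List.length-++ γ)) (ℕ.m<m+n (length γ) (s≤s z≤n)))

AvAt-first : ∀ {k} → 3 ≤ k → ∀ m → length (AvAt (Rk k) (suc m) 0) ≡ avCount (Rk k) m
AvAt-first {k} 3≤k m = length-≡-bijection (Unique-AvAt (Rk k) (suc m) 0) (Unique-Av (Rk k) m) (record
  { to      = drop 1
  ; from    = suc m ∷_
  ; to-∈    = to-∈
  ; from-∈  = from-∈
  ; from-to = from-to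
  ; to-from = λ _ → refl
  })
  where
  from-to : ∀ {σ} → σ ∈ AvAt (Rk k) (suc m) 0 → suc m ∷ drop 1 σ ≡ σ
  from-to σ∈ with AvAt-split {Rk k} {suc m} (s≤s z≤n) σ∈
  ... | [] , _ , refl , _ = refl
  ... | _ ∷ _ , _ , _ , ()

  to-∈ : ∀ {σ} → σ ∈ AvAt (Rk k) (suc m) 0 → drop 1 σ ∈ Av (Rk k) m
  to-∈ σ∈ with AvAt-split {Rk k} {suc m} (s≤s z≤n) σ∈ | ∈-AvAt⁻ {Rk k} {suc m} σ∈
  ... | _ ∷ _ , _ , _ , () | _
  ... | [] , τ , refl , _ | isPerm len (_ ∷ bounded) (m∉τ ∷ uτ) , av , _ =
    ∈-Av⁺ (isPerm (ℕ.suc-injective len) (All.tabulate below-max) uτ) (Avoids-⊆ (suc m ∷ʳ ⊆-refl) av)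
    where
    below-max : ∀ {v} → v ∈ τ → InRange m v
    below-max v∈ = let 1≤v , v≤1+m = All.lookup bounded v∈ in
                   1≤v , ℕ.≤-pred (ℕ.≤∧≢⇒< v≤1+m (All.lookup m∉τ v∈ ∘ sym))

  from-∈ : ∀ {τ} → τ ∈ Av (Rk k) m → suc m ∷ τ ∈ AvAt (Rk k) (suc m) 0
  from-∈ {τ} τ∈ with ∈-Av⁻ {Rk k} τ∈
  ... | isPerm len bounded uτ , av = ∈-AvAt⁺ {Rk k} {suc m} {0}
    (isPerm (cong suc len)
            ((s≤s z≤n , ℕ.≤-refl) ∷ All.map (λ (1≤v , v≤m) → 1≤v , ℕ.m≤n⇒m≤1+n v≤m) bounded)
            (All.map (λ (_ , v≤m) m≡v → ℕ.<-irrefl (sym m≡v) (s≤s v≤m)) bounded ∷ uτ))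
    (Avoids-∷-max 3≤k (All.map (λ (_ , v≤m) → s≤s v≤m) bounded) av)
    (posOf-++ {suc m} [] {τ} (λ ()))

AvAt-21-empty : ∀ {n a} → suc a < n → length (AvAt (Rk 2) n a) ≡ 0
AvAt-21-empty {n} {a} 1+a<n = cong length (no-member⇒[] not-21-avoiding)
  where
  not-21-avoiding : ∀ {σ} → σ ∉ AvAt (Rk 2) n a
  not-21-avoiding σ∈ with ∈-AvAt⁻ {Rk 2} σ∈ | AvAt-split {Rk 2} {n} (ℕ.≤-<-trans z≤n 1+a<n) σ∈
  ... | P , _ , _ | γ , [] , refl , len-γ = ℕ.<-irrefl 1+a≡n 1+a<n
    where
    1+a≡n : suc a ≡ n
    1+a≡n = trans (cong suc (sym len-γ))
                  (trans (ℕ.+-comm 1 (length γ)) (trans (sym (List.length-++ γ)) (length≡ P)))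
  ... | P , (_ ∷ _ ∷ ¬21 ∷ []) , _ | γ , d ∷ δ , refl , _ =
    ¬21 (occurrence (Sublist.++⁺ˡ γ (refl ∷ refl ∷ minimum δ)) twenty-one)
    where
    d<n : d < n
    d<n with Unique-++⁻ γ (unique P) | All.lookup (inRange P) (∈-++⁺ʳ γ (there (here refl)))
    ... | _ , (n∉ ∷ _) , _ | _ , d≤n = ℕ.≤∧≢⇒< d≤n (All.head n∉ ∘ sym)
    twenty-one : T (sameOrder (2 ∷ 1 ∷ []) (n ∷ d ∷ []))
    twenty-one = Equivalence.from (T-∧ {sameFirst 2 n (1 ∷ []) (d ∷ [])})
      ( Pointwise⇒sameFirst {2} {n} {1 ∷ []} {d ∷ []}
          (sameComparison {2} {1} {n} {d} (λ { (s≤s ()) }) (λ n<d → ⊥-elim (ℕ.<-asym n<d d<n)) ∷ [])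
      , _ )

-- Splitting an avoider at its maximum

collapse : ℕ → ℕ → ℕ
collapse b v = if does (v ≤? b) then 1 else suc (v ∸ b)

inflate : ℕ → ℕ → ℕ → ℕ
inflate b e zero          = zero
inflate b e (suc zero)    = e
inflate b e (suc (suc v)) = suc v + b

collapse-low : ∀ {b v} → v ≤ b → collapse b v ≡ 1
collapse-low {b} {v} v≤b = cong (λ c → if c then 1 else suc (v ∸ b)) (dec-true (v ≤? b) v≤b)

collapse-high : ∀ {b v} → b < v → collapse b v ≡ suc (v ∸ b)
collapse-high {b} {v} b<v = cong (λ c → if c then 1 else suc (v ∸ b)) (dec-false (v ≤? b) (ℕ.<⇒≱ b<v))

inflate-< : ∀ {b e v w} → e ≤ b → 1 ≤ v → v < w → inflate b e v < inflate b e w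
inflate-< {b} {v = suc zero}    {suc zero}    _   _ (s≤s ())
inflate-< {b} {v = suc zero}    {suc (suc w)} e≤b _ _ = ℕ.≤-<-trans e≤b (ℕ.m<n+m b (s≤s z≤n))
inflate-< {b} {v = suc (suc v)} {suc (suc w)} _   _ (s≤s v<w) = ℕ.+-monoˡ-< b v<w

collapse-inflate : ∀ {b e v} → e ≤ b → 1 ≤ v → collapse b (inflate b e v) ≡ v
collapse-inflate {b} {v = suc zero}    e≤b _ = collapse-low e≤b
collapse-inflate {b} {v = suc (suc v)} _   _ =
  trans (collapse-high (ℕ.m<n+m b (s≤s z≤n))) (cong suc (ℕ.m+n∸n≡m (suc v) b))

inflate-collapse : ∀ {b e v} → e ≤ b → v ≡ e ⊎ b < v → inflate b e (collapse b v) ≡ v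
inflate-collapse e≤b (inj₁ refl) rewrite collapse-low e≤b = refl
inflate-collapse {b} {e} {v} _ (inj₂ b<v) rewrite collapse-high b<v with v ∸ b in v∸b≡ | ℕ.m<n⇒0<n∸m b<v
... | suc t | _ = trans (cong (_+ b) (sym v∸b≡)) (ℕ.m∸n+n≡m (ℕ.<⇒≤ b<v))

inflate-range : ∀ {a b e v} → 1 ≤ v → v ≤ a → inflate b e v ≡ e ⊎ (b < inflate b e v × inflate b e v < a + b)
inflate-range {v = suc zero}    _ _   = inj₁ refl
inflate-range {b = b} {v = suc (suc v)} _ v≤a = inj₂ (ℕ.m<n+m b (s≤s z≤n) , ℕ.+-monoˡ-< b v≤a)

filter-low-inflate : ∀ {b e} α → e ≤ b → All (1 ≤_) α → Unique α → 1 ∈ α →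
                     filter (_≤? b) (map (inflate b e) α) ≡ [ e ]
filter-low-inflate {b} {e} (suc zero ∷ α) e≤b (_ ∷ α≥1) (1∉ ∷ _) _ =
  trans (List.filter-accept (_≤? b) e≤b) (cong (e ∷_) (List.filter-none (_≤? b) (All.map⁺ (All.tabulate high))))
  where
  high : ∀ {v} → v ∈ α → ¬ inflate b e v ≤ b
  high {v} v∈ with All.lookup α≥1 v∈ | All.lookup 1∉ v∈
  ... | s≤s {n = suc v′} _ | _ = ℕ.<⇒≱ (ℕ.m<n+m b (s≤s z≤n))
  ... | s≤s {n = zero}   _ | 1≢1 = ⊥-elim (1≢1 refl)
filter-low-inflate {b} {e} (suc (suc v) ∷ α) e≤b (_ ∷ α≥1) (_ ∷ uα) (there 1∈α) =
  trans (List.filter-reject (_≤? b) (ℕ.<⇒≱ (ℕ.m<n+m b (s≤s z≤n)))) (filter-low-inflate α e≤b α≥1 uα 1∈α)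

split : ℕ → ℕ → List ℕ → List ℕ × List ℕ
split a b σ = map (collapse b) (take a σ) , filter (_≤? b) σ

join : ℕ → ℕ → List ℕ × List ℕ → List ℕ
join a b (α , [])    = []
join a b (α , e ∷ δ) = map (inflate b e) α ++ (a + b) ∷ δ

module Decompose {k a b : ℕ} (2≤k : 2 ≤ k) (1≤a : 1 ≤ a) {γ δ : List ℕ} (length-γ : length γ ≡ a)
                 (P : IsPerm (a + b) (γ ++ (a + b) ∷ δ)) (av : Avoids (Rk k) (γ ++ (a + b) ∷ δ)) where

  n = a + b
  σ = γ ++ n ∷ δ

  unique-γ : Unique γ
  unique-γ = proj₁ (Unique-++⁻ γ (unique P))

  disjoint : Disjoint γ (n ∷ δ)
  disjoint = proj₂ (proj₂ (Unique-++⁻ γ (unique P)))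

  γ<n : All (_< n) γ
  γ<n = All.tabulate λ v∈ →
    ℕ.≤∧≢⇒< (proj₂ (All.lookup (inRange P) (∈-++⁺ˡ v∈))) (λ v≡n → disjoint (v∈ , here v≡n))

  δ<n : All (_< n) δ
  δ<n with proj₁ (proj₂ (Unique-++⁻ γ (unique P)))
  ... | n∉δ ∷ _ = All.tabulate λ v∈ →
    ℕ.≤∧≢⇒< (proj₂ (All.lookup (inRange P) (∈-++⁺ʳ γ (there v∈)))) (All.lookup n∉δ v∈ ∘ sym)

  b<n : b < n
  b<n = ℕ.m<n+m b 1≤a

  length-δ : suc (length δ) ≡ b
  length-δ = ℕ.+-cancelˡ-≡ a _ _
    (trans (cong (_+ suc (length δ)) (sym length-γ)) (trans (sym (List.length-++ γ)) (length≡ P)))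

  count-≤ : ∀ {v} → v < n → v ≡ length (filter (_≤? v) γ) + length (filter (_≤? v) δ)
  count-≤ {v} v<n = begin
    v                                                      ≡⟨ IsPerm-count-≤ P (ℕ.<⇒≤ v<n) ⟨
    length (filter (_≤? v) σ)                              ≡⟨ cong length (List.filter-++ (_≤? v) γ (n ∷ δ)) ⟩
    length (filter (_≤? v) γ ++ filter (_≤? v) (n ∷ δ))   ≡⟨ List.length-++ (filter (_≤? v) γ) ⟩
    length (filter (_≤? v) γ) + length (filter (_≤? v) (n ∷ δ))
      ≡⟨ cong (λ l → length (filter (_≤? v) γ) + length l) (List.filter-reject (_≤? v) (ℕ.<⇒≱ v<n)) ⟩
    length (filter (_≤? v) γ) + length (filter (_≤? v) δ) ∎
    where open ≡-Reasoning

  -- Two letters of γ below some d ∈ δ would form 1243 or 2143 together with n and d.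
  at-most-one-below : ∀ {d} → d ∈ δ → length (filter (_≤? d) γ) ≤ 1
  at-most-one-below {d} d∈δ = ℕ.≮⇒≥ two-below
    where
    two-below : ¬ 1 < length (filter (_≤? d) γ)
    two-below 2≤ with pair-⊆ 2≤
    ... | g₁ , g₂ , pair⊆ = compare (ℕ.<-cmp g₁ g₂)
      where
      pair⊆γ : g₁ ∷ g₂ ∷ [] ⊆ γ
      pair⊆γ = ⊆-trans pair⊆ (Sublist.filter-⊆ (_≤? d) γ)
      below-d : ∀ {g} → g ∈ g₁ ∷ g₂ ∷ [] → g < d
      below-d g∈ = ℕ.≤∧≢⇒< (All.lookup (Sublist.All-resp-⊆ pair⊆ (All.all-filter (_≤? d) γ)) g∈)
                           (λ { refl → disjoint (Sublist.Any-resp-⊆ pair⊆γ g∈ , there d∈δ) })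
      letters⊆σ : g₁ ∷ g₂ ∷ n ∷ d ∷ [] ⊆ σ
      letters⊆σ = Sublist.++⁺ pair⊆γ (refl ∷ from∈ d∈δ)
      d<n : d < n
      d<n = All.lookup δ<n d∈δ
      compare : Tri (g₁ < g₂) (g₁ ≡ g₂) (g₂ < g₁) → ⊥
      compare (tri< g₁<g₂ _ _) =
        All.head av (occurrence letters⊆σ (sameOrder-1243 g₁<g₂ (below-d (there (here refl))) d<n))
      compare (tri≈ _ g₁≡g₂ _) with Unique-⊆ pair⊆γ unique-γ
      ... | (g₁≢g₂ ∷ []) ∷ _ = g₁≢g₂ g₁≡g₂
      compare (tri> _ _ g₂<g₁) =
        All.head (All.tail av) (occurrence letters⊆σ (sameOrder-2143 g₂<g₁ (below-d (here refl)) d<n))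

  -- Of the d letters ≤ d in σ at most one lies in γ, so d ≤ 1 + length δ = b.
  δ≤b : All (_≤ b) δ
  δ≤b = All.tabulate λ {d} d∈δ → begin
    d                                                      ≡⟨ count-≤ (All.lookup δ<n d∈δ) ⟩
    length (filter (_≤? d) γ) + length (filter (_≤? d) δ)  ≤⟨ ℕ.+-mono-≤ (at-most-one-below d∈δ)
                                                                        (List.length-filter (_≤? d) δ) ⟩
    suc (length δ)                                         ≡⟨ length-δ ⟩
    b                                                      ∎
    where open ℕ.≤-Reasoning

  -- σ has b letters ≤ b, among them the b - 1 letters of δ.
  one-low-letter : ∃ λ e → filter (_≤? b) γ ≡ [ e ]
  one-low-letter = length≡1 (ℕ.+-cancelʳ-≡ (length δ) _ 1 (begin
    length (filter (_≤? b) γ) + length δ                   ≡⟨ cong (λ l → length (filter (_≤? b) γ) + length l)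
                                                                   (List.filter-all (_≤? b) δ≤b) ⟨
    length (filter (_≤? b) γ) + length (filter (_≤? b) δ)  ≡⟨ count-≤ b<n ⟨
    b                                                      ≡⟨ length-δ ⟨
    suc (length δ)                                         ∎))
    where open ≡-Reasoning

  e = proj₁ one-low-letter

  low-γ : filter (_≤? b) γ ≡ [ e ]
  low-γ = proj₂ one-low-letter

  e≤b : e ≤ b
  e≤b = proj₂ (∈-filter⁻ (_≤? b) {xs = γ} (subst (e ∈_) (sym low-γ) (here refl)))

  γ-letter : ∀ {v} → v ∈ γ → v ≡ e ⊎ b < v
  γ-letter {v} v∈ with v ≤? b
  ... | yes v≤b = inj₁ (singleton⁻ (subst (v ∈_) low-γ (∈-filter⁺ (_≤? b) v∈ v≤b)))
  ... | no  v≰b = inj₂ (ℕ.≰⇒> v≰b)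

  collapse-increasing : IncreasingOn (collapse b) γ
  collapse-increasing v∈ w∈ v<w with γ-letter v∈ | γ-letter w∈
  ... | inj₁ refl | inj₁ refl = ⊥-elim (ℕ.<-irrefl refl v<w)
  ... | inj₁ refl | inj₂ b<w  rewrite collapse-low e≤b | collapse-high b<w = s≤s (ℕ.m<n⇒0<n∸m b<w)
  ... | inj₂ b<v  | inj₁ refl = ⊥-elim (ℕ.<-asym b<v (ℕ.<-≤-trans v<w e≤b))
  ... | inj₂ b<v  | inj₂ b<w  rewrite collapse-high b<v | collapse-high b<w =
    s≤s (ℕ.∸-monoˡ-< v<w (ℕ.<⇒≤ b<v))

  α = map (collapse b) γ

  α-perm : IsPerm a α
  α-perm = isPerm
    (trans (List.length-map (collapse b) γ) length-γ)
    (All.map⁺ (All.tabulate in-range))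
    (Unique-map⁺ (collapse b) (increasing⇒injective collapse-increasing) unique-γ)
    where
    in-range : ∀ {v} → v ∈ γ → InRange a (collapse b v)
    in-range v∈ with γ-letter v∈
    ... | inj₁ refl rewrite collapse-low e≤b = s≤s z≤n , 1≤a
    ... | inj₂ b<v  rewrite collapse-high b<v =
      s≤s z≤n , subst (_ <_) (ℕ.m+n∸n≡m a b) (ℕ.∸-monoˡ-< (All.lookup γ<n v∈) (ℕ.<⇒≤ b<v))

  α-avoids : Avoids (Rk (k ∸ 1)) α
  α-avoids = Equivalence.from (Avoids-map (increasing⇒OrderPreserving collapse-increasing))
    (Equivalence.to (Avoids-∷ʳ-max 2≤k γ<n) (Avoids-⊆ (Sublist.++⁺ ⊆-refl (refl ∷ minimum δ)) av))

  low-σ : filter (_≤? b) σ ≡ e ∷ δ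
  low-σ = begin
    filter (_≤? b) (γ ++ n ∷ δ)                ≡⟨ List.filter-++ (_≤? b) γ (n ∷ δ) ⟩
    filter (_≤? b) γ ++ filter (_≤? b) (n ∷ δ) ≡⟨ cong₂ _++_ low-γ (List.filter-reject (_≤? b) (ℕ.<⇒≱ b<n)) ⟩
    e ∷ filter (_≤? b) δ                       ≡⟨ cong (e ∷_) (List.filter-all (_≤? b) δ≤b) ⟩
    e ∷ δ                                      ∎
    where open ≡-Reasoning

  β-perm : IsPerm b (e ∷ δ)
  β-perm = isPerm length-δ
    (All.tabulate λ v∈ → let v∈σ , v≤b = ∈-filter⁻ (_≤? b) (subst (_ ∈_) (sym low-σ) v∈) in
                         proj₁ (All.lookup (inRange P) v∈σ) , v≤b)
    (subst Unique low-σ (Unique.filter⁺ (_≤? b) (unique P)))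

  β-avoids : Avoids (Rk k) (e ∷ δ)
  β-avoids = Avoids-⊆ (subst (_⊆ σ) low-σ (Sublist.filter-⊆ (_≤? b) σ)) av

  split-σ : split a b σ ≡ (α , e ∷ δ)
  split-σ = cong₂ _,_ (cong (map (collapse b)) (subst (λ a → take a σ ≡ γ) length-γ (take-length-++ γ))) low-σ

  join-split : join a b (split a b σ) ≡ σ
  join-split rewrite split-σ =
    cong (_++ n ∷ δ) (trans (sym (List.map-∘ γ))
                            (List.map-id-local (All.tabulate (inflate-collapse e≤b ∘ γ-letter))))

module Recompose {k a b : ℕ} (2≤k : 2 ≤ k) (3≤k⊎b≡1 : 3 ≤ k ⊎ b ≡ 1) (1≤a : 1 ≤ a) {α δ : List ℕ} {e : ℕ}
                 (Pα : IsPerm a α) (avα : Avoids (Rk (k ∸ 1)) α)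
                 (Pβ : IsPerm b (e ∷ δ)) (avβ : Avoids (Rk k) (e ∷ δ)) where

  n = a + b
  γ = map (inflate b e) α
  σ = γ ++ n ∷ δ

  e≤b : e ≤ b
  e≤b = proj₂ (All.head (inRange Pβ))

  δ≤b : All (_≤ b) δ
  δ≤b = All.map proj₂ (All.tail (inRange Pβ))

  b<n : b < n
  b<n = ℕ.m<n+m b 1≤a

  α-positive : All (1 ≤_) α
  α-positive = All.map proj₁ (inRange Pα)

  inflate-increasing : ∀ {ρ} → All (1 ≤_) ρ → IncreasingOn (inflate b e) ρ
  inflate-increasing ρ-positive v∈ _ v<w = inflate-< e≤b (All.lookup ρ-positive v∈) v<w

  γ-letter : ∀ {x} → x ∈ γ → x ≡ e ⊎ (b < x × x < n)
  γ-letter x∈ with ∈-map⁻ (inflate b e) x∈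
  ... | v , v∈ , refl = let 1≤v , v≤a = All.lookup (inRange Pα) v∈ in inflate-range 1≤v v≤a

  γ<n : All (_< n) γ
  γ<n = All.tabulate λ x∈ → Sum.[ (λ { refl → ℕ.≤-<-trans e≤b b<n }) , proj₂ ] (γ-letter x∈)

  disjoint : Disjoint γ (n ∷ δ)
  disjoint (x∈γ , here refl) = ℕ.<-irrefl refl (All.lookup γ<n x∈γ)
  disjoint (x∈γ , there x∈δ) with γ-letter x∈γ | unique Pβ
  ... | inj₁ refl      | e∉δ ∷ _ = All.lookup e∉δ x∈δ refl
  ... | inj₂ (b<x , _) | _       = ℕ.<⇒≱ b<x (All.lookup δ≤b x∈δ)

  length-γ : length γ ≡ a
  length-γ = trans (List.length-map _ α) (length≡ Pα)

  σ-perm : IsPerm n σ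
  σ-perm = isPerm
    (trans (List.length-++ γ) (cong₂ _+_ length-γ (length≡ Pβ)))
    (All.++⁺ (All.tabulate γ-range)
             ((ℕ.≤-trans 1≤a (ℕ.m≤m+n a b) , ℕ.≤-refl) ∷ All.map below-n (All.tail (inRange Pβ))))
    (Unique.++⁺ (Unique-map⁺ (inflate b e) (increasing⇒injective (inflate-increasing α-positive)) (unique Pα))
                (All.map (λ v≤b n≡v → ℕ.<⇒≱ b<n (subst (_≤ b) (sym n≡v) v≤b)) δ≤b
                 ∷ Unique-⊆ (_ ∷ʳ ⊆-refl) (unique Pβ))
                disjoint)
    where
    below-n : ∀ {v} → InRange b v → InRange n v
    below-n (1≤v , v≤b) = 1≤v , ℕ.≤-trans v≤b (ℕ.<⇒≤ b<n)
    γ-range : ∀ {x} → x ∈ γ → InRange n x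
    γ-range x∈ with γ-letter x∈
    ... | inj₁ refl        = below-n (All.head (inRange Pβ))
    ... | inj₂ (b<x , x<n) = ℕ.≤-trans (s≤s z≤n) b<x , ℕ.<⇒≤ x<n

  σ-position : posOf n σ ≡ a
  σ-position = trans (posOf-++ γ (λ n∈γ → ℕ.<-irrefl refl (All.lookup γ<n n∈γ))) length-γ

  low-γ : filter (_≤? b) γ ≡ [ e ]
  low-γ = filter-low-inflate α e≤b α-positive (unique Pα) (IsPerm-∈ Pα (s≤s z≤n , 1≤a))

  low-n∷ : ∀ δ → filter (_≤? b) (n ∷ δ) ≡ filter (_≤? b) δ
  low-n∷ δ = List.filter-reject (_≤? b) (ℕ.<⇒≱ b<n)

  γn-avoids : Avoids (Rk k) (γ ++ [ n ])
  γn-avoids = subst (Avoids (Rk k)) γn≡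
    (Equivalence.from
      (Avoids-map (increasing⇒OrderPreserving (inflate-increasing (All.++⁺ α-positive (s≤s z≤n ∷ [])))))
      (Equivalence.from (Avoids-∷ʳ-max 2≤k (All.map (λ (_ , v≤a) → s≤s v≤a) (inRange Pα))) avα))
    where
    top : ∀ {a} → 1 ≤ a → inflate b e (suc a) ≡ a + b
    top {suc _} _ = refl
    γn≡ : map (inflate b e) (α ++ [ suc a ]) ≡ γ ++ [ n ]
    γn≡ = trans (List.map-++ (inflate b e) α [ suc a ]) (cong (λ x → γ ++ [ x ]) (top 1≤a))

  σ-avoids : Avoids (Rk k) σ
  σ-avoids = avoids 3≤k⊎b≡1
    where
    avoids : 3 ≤ k ⊎ b ≡ 1 → Avoids (Rk k) σ
    avoids (inj₂ b≡1) = subst (λ δ → Avoids (Rk k) (γ ++ n ∷ δ))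
                              (sym (length≡0⇒[] (ℕ.suc-injective (trans (length≡ Pβ) b≡1)))) γn-avoids
    avoids (inj₁ 3≤k) = All.tabulate λ {π} π∈ c → Sum.[ All.lookup γn-avoids π∈ , All.lookup avβ π∈ ]
      (Contains-split-at-threshold (All.lookup (Rk-EndsAboveFirstTwo 3≤k) π∈)
        (trans (List.filter-++ (_≤? b) γ [ n ]) (cong₂ _++_ low-γ (low-n∷ [])))
        δ≤b (subst (λ s → Contains s π) (sym (List.++-assoc γ [ n ] δ)) c))

  split-σ : split a b σ ≡ (α , e ∷ δ)
  split-σ = cong₂ _,_
    (begin
      map (collapse b) (take a σ)      ≡⟨ cong (map (collapse b))
                                               (subst (λ a → take a σ ≡ γ) length-γ (take-length-++ γ)) ⟩
      map (collapse b) γ               ≡⟨ List.map-∘ α ⟨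
      map (collapse b ∘ inflate b e) α ≡⟨ List.map-id-local (All.map (collapse-inflate e≤b) α-positive) ⟩
      α                                ∎)
    (begin
      filter (_≤? b) (γ ++ n ∷ δ)                ≡⟨ List.filter-++ (_≤? b) γ (n ∷ δ) ⟩
      filter (_≤? b) γ ++ filter (_≤? b) (n ∷ δ) ≡⟨ cong₂ _++_ low-γ (low-n∷ δ) ⟩
      e ∷ filter (_≤? b) δ                       ≡⟨ cong (e ∷_) (List.filter-all (_≤? b) δ≤b) ⟩
      e ∷ δ                                      ∎)
    where open ≡-Reasoning

-- For k = 2 an occurrence of 21 can run from γ into δ, so there only b = 1 is covered.
AvAt-product : ∀ {k a b} → 2 ≤ k → 3 ≤ k ⊎ b ≡ 1 → 1 ≤ a → 1 ≤ b →
               length (AvAt (Rk k) (a + b) a) ≡ avCount (Rk (k ∸ 1)) a * avCount (Rk k) b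
AvAt-product {k} {a} {b} 2≤k 3≤k⊎b≡1 1≤a 1≤b = trans
  (length-≡-bijection (Unique-AvAt (Rk k) (a + b) a)
                      (Unique.cartesianProduct⁺ (Unique-Av (Rk (k ∸ 1)) a) (Unique-Av (Rk k) b))
                      (record { to = split a b ; from = join a b
                              ; to-∈ = proj₁ ∘ decompose ; from-∈ = proj₁ ∘ recompose
                              ; from-to = proj₂ ∘ decompose ; to-from = proj₂ ∘ recompose }))
  (length-cartesianProduct (Av (Rk (k ∸ 1)) a) (Av (Rk k) b))
  where
  Pairs = cartesianProduct (Av (Rk (k ∸ 1)) a) (Av (Rk k) b)

  decompose : ∀ {σ} → σ ∈ AvAt (Rk k) (a + b) a → split a b σ ∈ Pairs × join a b (split a b σ) ≡ σ
  decompose σ∈ with AvAt-split {Rk k} {a + b} (ℕ.≤-trans 1≤a (ℕ.m≤m+n a b)) σ∈ | ∈-AvAt⁻ {Rk k} {a + b} σ∈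
  ... | γ , δ , refl , length-γ | P , av , _ =
    subst (_∈ Pairs) (sym D.split-σ)
          (∈-cartesianProduct⁺ (∈-Av⁺ D.α-perm D.α-avoids) (∈-Av⁺ D.β-perm D.β-avoids))
    , D.join-split
    where module D = Decompose 2≤k 1≤a length-γ P av

  recompose : ∀ {p} → p ∈ Pairs → join a b p ∈ AvAt (Rk k) (a + b) a × split a b (join a b p) ≡ p
  recompose {α , β} p∈ with ∈-cartesianProduct⁻ (Av (Rk (k ∸ 1)) a) (Av (Rk k) b) p∈
  ... | α∈ , β∈ with ∈-Av⁻ {Rk (k ∸ 1)} {a} α∈ | ∈-Av⁻ {Rk k} {b} β∈
  recompose {α , []}    _ | _ | _         | Pβ , _   = ⊥-elim (ℕ.<-irrefl (length≡ Pβ) 1≤b)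
  recompose {α , e ∷ δ} _ | _ | Pα , avα | Pβ , avβ =
    ∈-AvAt⁺ R.σ-perm R.σ-avoids R.σ-position , R.split-σ
    where module R = Recompose 2≤k 3≤k⊎b≡1 1≤a Pα avα Pβ avβ

-- The counting sequences satisfy the recurrence of K

avSeries : ℕ → Series
avSeries k n = + avCount (Rk k) n

avSeries-recurrence : ∀ {k} → 3 ≤ k → KRecurrence (avSeries (k ∸ 1)) (avSeries k)
avSeries-recurrence {k} 3≤k = record { at-one = refl ; at-suc-suc = step }
  where
  split-count : ∀ n i → i < suc n → + length (AvAt (Rk k) (suc (suc n)) (suc i)) ≡
                avSeries (k ∸ 1) (suc i) ℤ.* avSeries k (suc (n ∸ i))
  split-count n i (s≤s i≤n) = trans (cong +_ (subst
    (λ m → length (AvAt (Rk k) m (suc i)) ≡ avCount (Rk (k ∸ 1)) (suc i) * avCount (Rk k) (suc (n ∸ i)))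
    (cong suc (trans (ℕ.+-suc i (n ∸ i)) (cong suc (ℕ.m+[n∸m]≡n i≤n))))
    (AvAt-product {k} {suc i} {suc (n ∸ i)} (ℕ.≤-trans (s≤s (s≤s z≤n)) 3≤k) (inj₁ 3≤k) (s≤s z≤n) (s≤s z≤n))))
    (ℤ.pos-* (avCount (Rk (k ∸ 1)) (suc i)) _)

  step : ∀ n → avSeries k (suc (suc n)) ≡
         avSeries k (suc n) ℤ.+ sumBelow (suc n) (λ i → avSeries (k ∸ 1) (suc i) ℤ.* avSeries k (suc (n ∸ i)))
  step n = begin
    avSeries k (suc (suc n))
      ≡⟨ avCount-by-position (Rk k) (suc n) ⟩
    sumBelow (suc (suc n)) (λ a → + length (AvAt (Rk k) (suc (suc n)) a))
      ≡⟨ sumBelow-suc (suc n) _ ⟩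
    + length (AvAt (Rk k) (suc (suc n)) 0) ℤ.+
    sumBelow (suc n) (λ i → + length (AvAt (Rk k) (suc (suc n)) (suc i)))
      ≡⟨ cong₂ ℤ._+_ (cong +_ (AvAt-first 3≤k (suc n))) (sumBelow-cong (suc n) (split-count n _)) ⟩
    avSeries k (suc n) ℤ.+ sumBelow (suc n) (λ i → avSeries (k ∸ 1) (suc i) ℤ.* avSeries k (suc (n ∸ i))) ∎
    where open ≡-Reasoning

-- A 21-avoider ends with its maximum, and as Rk 1 = Rk 2, AvAt-product counts those of length
-- n + 2 by avCount (Rk 2) (suc n) * 1.
avSeries-R2-recurrence : KRecurrence 0s (avSeries 2)
avSeries-R2-recurrence = record { at-one = refl ; at-suc-suc = step }
  where
  step : ∀ n → avSeries 2 (suc (suc n)) ≡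
         avSeries 2 (suc n) ℤ.+ sumBelow (suc n) (λ i → 0s (suc i) ℤ.* avSeries 2 (suc (n ∸ i)))
  step n = begin
    avSeries 2 (suc (suc n))
      ≡⟨ avCount-by-position (Rk 2) (suc n) ⟩
    sumBelow (suc n) (λ a → + length (AvAt (Rk 2) (suc (suc n)) a)) ℤ.+
    + length (AvAt (Rk 2) (suc (suc n)) (suc n))
      ≡⟨ cong₂ ℤ._+_ (sumBelow-zero (suc n) (λ a<1+n → cong +_ (AvAt-21-empty (s≤s a<1+n))))
                     (cong +_ max-last) ⟩
    + 0 ℤ.+ avSeries 2 (suc n)
      ≡⟨ ℤ.+-comm (+ 0) (avSeries 2 (suc n)) ⟩
    avSeries 2 (suc n) ℤ.+ + 0
      ≡⟨ cong (ℤ._+_ (avSeries 2 (suc n))) (sumBelow-zero (suc n) (λ _ → refl)) ⟨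
    avSeries 2 (suc n) ℤ.+ sumBelow (suc n) (λ i → 0s (suc i) ℤ.* avSeries 2 (suc (n ∸ i))) ∎
    where
    open ≡-Reasoning
    max-last : length (AvAt (Rk 2) (suc (suc n)) (suc n)) ≡ avCount (Rk 2) (suc n)
    max-last = trans (subst (λ m → length (AvAt (Rk 2) m (suc n)) ≡ avCount (Rk 2) (suc n) * 1)
                            (ℕ.+-comm (suc n) 1)
                            (AvAt-product {2} {suc n} {1} ℕ.≤-refl (inj₂ refl) (s≤s z≤n) (s≤s z≤n)))
                     (ℕ.*-identityʳ _)

avSeries≡K : ∀ i n → avSeries (2 + i) (suc n) ≡ K (suc i) (suc n)
avSeries≡K zero    = KRecurrence-unique (λ _ → refl) avSeries-R2-recurrence (K-recurrence 0)
avSeries≡K (suc i) =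
  KRecurrence-unique (avSeries≡K i) (avSeries-recurrence (s≤s (s≤s (s≤s z≤n)))) (K-recurrence (suc i))

corollary6p10 : (k : ℕ) → 2 ≤ k → (n : ℕ) →
    + avCount (Rk k) n ≡ (1s ⊕ K (k ∸ 1)) n
corollary6p10 k (s≤s (s≤s _))         zero    = refl
corollary6p10 k (s≤s (s≤s {n = i} _)) (suc n) = trans (avSeries≡K i n) (sym (ℤ.+-identityˡ _))
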